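{- Let $a=(a_k)_{k\ge1}$ and $b=(b_k)_{k\ge1}$ be sequences of complex numbers with $a_1=b_1=0$, and let $\mu$ be a strict partition. Then $$Q_{\mu;a}=\sum_{\nu\in DP,\ \ell(\nu)=\ell(\mu),\ \nu\subset\mu}d_{\mu\nu}\,Q_{\nu;b},\qquad d_{\mu\nu}=\det\bigl((d_{\mu_i\nu_j}(a,b))_{1\le i,j\le\ell(\mu)}\bigr).$$
   Context: $DP$ is the set of strict partitions $\lambda=(\lambda_1>\dots>\lambda_l>0)$, $\ell(\lambda)=l$; $\nu\subset\mu$ means $\ell(\nu)\le\ell(\mu)$ and $\nu_i\le\mu_i$ for $i\le\ell(\nu)$. Put $(x\mid c)^k=\prod_{m=1}^k(x-c_m)$ for a sequence $c$. For $\lambda\in DP$ and $m\ge\ell(\lambda)=l$, $$P_{\lambda;c}(x_1,\dots,x_m)=\frac1{(m-l)!}\sum_{\omega\in S(m)}\prod_{i=1}^l (x_{\omega(i)}\mid c)^{\lambda_i}\prod_{1\le i\le l,\ i<j\le m}\frac{x_{\omega(i)}+x_{\omega(j)}}{x_{\omega(i)}-x_{\omega(j)}},$$ and $0$ if $m<l$, defining an element $P_{\lambda;c}$ of the algebra $\Gamma$ of supersymmetric functions (stable sequences of supersymmetric polynomials); $Q_{\lambda;c}=2^{\ell(\lambda)}P_{\lambda;c}$. Super complete homogeneous functions: $\sum_{k\ge0}h_k(y_1,\dots,y_p;z_1,\dots,z_q)t^k=\prod_{m=1}^q(1+z_mt)\big/\prod_{m=1}^p(1-y_mt)$. For integers $r\ge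 r'\ge0$ put $d_{rr'}(a,b)=h_{r-r'}(b_2,\dots,b_{r'+1};-a_2,\dots,-a_r)$, and $d_{rr'}(a,b)=0$ if $r<r'$. -}

module Defs where

open import Level using (Level; _⊔_) renaming (suc to lsuc)
open import Data.Nat as ℕ using (ℕ; zero; suc; _<ᵇ_; _∸_)
open import Data.Bool using (Bool; true; false; _∧_; if_then_else_)
open import Data.Fin using (Fin; zero; suc; toℕ; punchIn)
open import Data.List using (List; []; _∷_; map; concatMap; filter; foldr; length; allFin; upTo)
open import Data.List using () renaming (filterᵇ to filterB)
open import Relation.Nullary using (¬_)
open import Relation.Binary.PropositionalEquality using (_≡_)
open import Algebra.Bundles using (CommutativeRing)

-- Fields of characteristic zero (the paper works over ℂ).
-- A commutative ring with a total inverse operation that is a genuine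
-- inverse on nonzero elements, and n·1 ≠ 0 for all n ≥ 1.

sucOne : ∀ {c ℓ} (R : CommutativeRing c ℓ) → ℕ → CommutativeRing.Carrier R
sucOne R zero    = CommutativeRing.1# R
sucOne R (suc n) = CommutativeRing._+_ R (CommutativeRing.1# R) (sucOne R n)

record CharZeroField (c ℓ : Level) : Set (lsuc (c ⊔ ℓ)) where
  field
    cring : CommutativeRing c ℓ
  open CommutativeRing cring public
  field
    _⁻¹      : Carrier → Carrier
    inverseʳ : ∀ x → ¬ (x ≈ 0#) → (x * (x ⁻¹)) ≈ 1#
    charZero : ∀ n → ¬ (sucOne cring n ≈ 0#)

isStrictᵇ : List ℕ → Bool
isStrictᵇ []              = true
isStrictᵇ (x ∷ [])        = 0 <ᵇ x
isStrictᵇ (x ∷ y ∷ r)     = (y <ᵇ x) ∧ isStrictᵇ (y ∷ r)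

oneTo : ℕ → List ℕ
oneTo k = map suc (upTo k)

boxes : List ℕ → List (List ℕ)
boxes []      = [] ∷ []
boxes (k ∷ r) = concatMap (λ v → map (v ∷_) (boxes r)) (oneTo k)

subDP : List ℕ → List (List ℕ)
subDP μ = filterB isStrictᵇ (boxes μ)

-- i-th part (0-based), 0 beyond the length
part : List ℕ → ℕ → ℕ
part []      _       = 0
part (x ∷ _) zero    = x
part (_ ∷ r) (suc i) = part r i

-- Permutations of Fin m: every permutation of Fin (suc m) is uniquely
-- 0 ↦ k, suc i ↦ punchIn k (σ i) for σ ∈ S(m), k ∈ Fin (suc m).

perms : (m : ℕ) → List (Fin m → Fin m)
perms zero    = (λ i → i) ∷ []
perms (suc m) = concatMap (λ k → map (ext k) (perms m)) (allFin (suc m))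
  where
    ext : Fin (suc m) → (Fin m → Fin m) → Fin (suc m) → Fin (suc m)
    ext k σ zero    = k
    ext k σ (suc i) = punchIn k (σ i)

module _ {c ℓ} (F : CharZeroField c ℓ) where
  open CharZeroField F hiding (zero)

  sumL : List Carrier → Carrier
  sumL = foldr _+_ 0#

  prodL : List Carrier → Carrier
  prodL = foldr _*_ 1#

  ℕ→C : ℕ → Carrier
  ℕ→C zero    = 0#
  ℕ→C (suc n) = 1# + ℕ→C n

  fact : ℕ → ℕ
  fact zero    = 1
  fact (suc n) = suc n ℕ.* fact n

  pow : Carrier → ℕ → Carrier
  pow x zero    = 1#
  pow x (suc n) = x * pow x n

  -- (x | c)^k = ∏_{m=1}^k (x - c_m); sequences c : ℕ → Carrier, c m = c_m (c 0 unused)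
  fpow : Carrier → (ℕ → Carrier) → ℕ → Carrier
  fpow x c k = prodL (map (λ m → x - c m) (oneTo k))

  Pfun : List ℕ → (ℕ → Carrier) → (m : ℕ) → (Fin m → Carrier) → Carrier
  Pfun λ' c m x =
    if m ℕ.<ᵇ l then 0#
    else (ℕ→C (fact (m ∸ l)) ⁻¹) * sumL (map term (perms m))
    where
      l = length λ'
      term : (Fin m → Fin m) → Carrier
      term ω = prodL (map fac (allFin m))
        where
          fac : Fin m → Carrier
          fac i = if toℕ i <ᵇ l
                  then fpow (x (ω i)) c (part λ' (toℕ i))
                       * prodL (map (λ j → if toℕ i <ᵇ toℕ j
                                         then (x (ω i) + x (ω j)) * ((x (ω i) - x (ω j)) ⁻¹)
                                         else 1#)
                                    (allFin m))
                  else 1#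

  Qfun : List ℕ → (ℕ → Carrier) → (m : ℕ) → (Fin m → Carrier) → Carrier
  Qfun λ' c m x = pow (1# + 1#) (length λ') * Pfun λ' c m x

  Series : Set c
  Series = ℕ → Carrier

  sumTo : ℕ → (ℕ → Carrier) → Carrier
  sumTo zero    f = f 0
  sumTo (suc k) f = sumTo k f + f (suc k)

  _⊛_ : Series → Series → Series
  (f ⊛ g) k = sumTo k (λ i → f i * g (k ∸ i))

  oneS : Series
  oneS zero    = 1#
  oneS (suc _) = 0#

  linS : Carrier → Series
  linS z zero          = 1#
  linS z (suc zero)    = z
  linS z (suc (suc _)) = 0#

  geomS : Carrier → Series
  geomS y n = pow y n

  -- super complete homogeneous function h_k(y₁…y_p ; z₁…z_q):
  -- coefficient of t^k in ∏(1 + z t) / ∏(1 - y t)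
  superH : ℕ → List Carrier → List Carrier → Carrier
  superH k ys zs = (foldr _⊛_ oneS (map linS zs) ⊛ foldr _⊛_ oneS (map geomS ys)) k

  twoTo : ℕ → List ℕ
  twoTo n = map suc (oneTo n)

  dcoef : ℕ → ℕ → (ℕ → Carrier) → (ℕ → Carrier) → Carrier
  dcoef r r' a b =
    if r ℕ.<ᵇ r' then 0#
    else superH (r ∸ r') (map b (twoTo r')) (map (λ k → - a k) (twoTo (r ∸ 1)))

  det : (n : ℕ) → (Fin n → Fin n → Carrier) → Carrier
  det zero    M = 1#
  det (suc n) M = sumL (map (λ k → sgn (toℕ k) * (M zero k * det n (λ i j → M (suc i) (punchIn k j))))
                            (allFin (suc n)))
    where
      sgn : ℕ → Carrier
      sgn zero    = 1#
      sgn (suc k) = - sgn k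

  dmat : List ℕ → List ℕ → (ℕ → Carrier) → (ℕ → Carrier) → Carrier
  dmat μ ν a b = det (length μ) (λ i j → dcoef (part μ (toℕ i)) (part ν (toℕ j)) a b)

{-# OPTIONS --safe #-}
module Submission where

-- Expanding the permutation sum along the point that receives the first part turns P_{μ;a} into an
-- iterated sum Pexp in which the i-th part only enters through the one-variable factor (x | a)^{μ_i};
-- Pexp is multilinear in these factors and, for distinct x, alternating under exchange of two adjacent
-- ones. The super complete homogeneous functions satisfy the recursion of the change of basis
-- (x | a)^r = Σ_{1 ≤ v ≤ r} d_{rv}(a,b) (x | b)^v, so multilinearity writes P_{μ;a} as a sum over all
-- ν ∈ [1, μ_1]^ℓ of Π_i d_{μ_i ν_i} · P_{ν;b}. Alternation collects the terms belonging to the same strict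
-- partition into the determinant det(d_{μ_i ν_j}), and since d_{rv} = 0 for r < v, that determinant
-- vanishes unless ν ⊂ μ.

open import Defs
open import Algebra.Bundles using (CommutativeMonoid)
open import Data.Nat as ℕ using (ℕ; zero; suc; _∸_; _<ᵇ_; _≤_; _<_; _≥_; z≤n; s≤s; NonZero)
import Data.Nat.Properties as ℕₚ
open import Data.Fin using (Fin; zero; suc; toℕ; punchIn; punchOut; _≟_)
open import Data.Fin.Properties using (toℕ<n; punchIn-injective; punchIn-mono-≤; punchInᵢ≢i; punchOut-punchIn; punchOut-cong)
open import Data.Bool using (Bool; true; false; T; if_then_else_)
open import Data.Bool.Properties using (T-∧; T-≡)
open import Data.List using (List; []; _∷_; _++_; map; upTo; foldr; concatMap; allFin; tabulate; length; filterᵇ)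
open import Data.List.Properties using (length-map; length-++; length-tabulate; map-++; upTo-∷ʳ; length-upTo)
open import Data.List.Relation.Unary.All as All using (All; []; _∷_)
open import Data.List.Relation.Unary.Any using (here; there)
open import Data.List.Membership.Propositional using (_∈_)
open import Data.List.Relation.Unary.All.Properties using (concat⁺; map⁺; tabulate⁺)
open import Data.Empty using (⊥-elim)
open import Data.Sum using (inj₁; inj₂)
open import Data.Product using (∃; _,_; proj₁; proj₂)
open import Data.List.Relation.Binary.Pointwise using (Pointwise; []; _∷_)
open import Function using (_∘_; id)
open import Function.Bundles using (module Equivalence)
open import Level using (_⊔_)
open import Relation.Nullary using (¬_; yes; no)
open import Relation.Binary.PropositionalEquality as ≡ using (_≡_)

module BigOperator {a ℓ} (M : CommutativeMonoid a ℓ) where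
  open CommutativeMonoid M
  open import Algebra.Properties.CommutativeMonoid.Sum M as Sum using ()
  open import Relation.Binary.Reasoning.Setoid setoid

  foldr-map-++ : ∀ {b} {B : Set b} (f : B → Carrier) xs ys →
                 foldr _∙_ ε (map f (xs ++ ys)) ≈ foldr _∙_ ε (map f xs) ∙ foldr _∙_ ε (map f ys)
  foldr-map-++ f []       ys = sym (identityˡ _)
  foldr-map-++ f (x ∷ xs) ys = trans (∙-congˡ (foldr-map-++ f xs ys)) (sym (assoc _ _ _))

  -- Opaque, so that ⨁ (suc n) f stays rigid and f can be inferred by unification.
  opaque
    ⨁ : ∀ n → (Fin n → Carrier) → Carrier
    ⨁ n f = Sum.sum f

  opaque
    unfolding ⨁

    ⨁-zero : (f : Fin 0 → Carrier) → ⨁ 0 f ≈ ε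
    ⨁-zero f = refl

    ⨁-suc : ∀ n (f : Fin (suc n) → Carrier) → ⨁ (suc n) f ≈ f zero ∙ ⨁ n (f ∘ suc)
    ⨁-suc n f = refl

    ⨁-cong : ∀ n {f g : Fin n → Carrier} → (∀ i → f i ≈ g i) → ⨁ n f ≈ ⨁ n g
    ⨁-cong n f≈g = Sum.sum-cong-≋ f≈g

    ⨁-remove : ∀ n (f : Fin (suc n) → Carrier) k → ⨁ (suc n) f ≈ f k ∙ ⨁ n (f ∘ punchIn k)
    ⨁-remove n f k = Sum.sum-remove {i = k} f

    ⨁-distrib : ∀ n (f g : Fin n → Carrier) → ⨁ n (λ i → f i ∙ g i) ≈ ⨁ n f ∙ ⨁ n g
    ⨁-distrib n = Sum.∑-distrib-+

    ⨁-comm : ∀ m n (f : Fin m → Fin n → Carrier) → ⨁ m (λ i → ⨁ n (f i)) ≈ ⨁ n (λ j → ⨁ m (λ i → f i j))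
    ⨁-comm m n = Sum.∑-comm

    ⨁-ε : ∀ n {f : Fin n → Carrier} → (∀ i → f i ≈ ε) → ⨁ n f ≈ ε
    ⨁-ε n f≈ε = trans (Sum.sum-cong-≋ f≈ε) (Sum.sum-replicate-zero n)

    foldr-map-allFin : ∀ n (f : Fin n → Carrier) → foldr _∙_ ε (map f (allFin n)) ≈ ⨁ n f
    foldr-map-allFin n f = reflexive (go f id)
      where
      go : ∀ {n} {B : Set} (f : B → Carrier) (g : Fin n → B) → foldr _∙_ ε (map f (tabulate g)) ≡ Sum.sum (f ∘ g)
      go {zero}  f g = ≡.refl
      go {suc n} f g = ≡.cong (f (g zero) ∙_) (go f (g ∘ suc))

module FactorialQ {c ℓ} (F : CharZeroField c ℓ) where
  open CharZeroField F hiding (zero)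
  open import Algebra.Properties.Ring ring
    using (-‿distribˡ-*; -‿distribʳ-*; -‿involutive; -0#≈0#; -‿+-comm; -1*x≈-x; ⁻¹-anti-homo‿-; x∙y⁻¹≈ε⇒x≈y)
  open BigOperator +-commutativeMonoid using ()
    renaming (⨁ to ∑; ⨁-zero to ∑-empty; ⨁-suc to ∑-suc; ⨁-cong to ∑-cong; ⨁-remove to ∑-remove;
              ⨁-distrib to ∑-distrib-+; ⨁-comm to ∑-comm; ⨁-ε to ∑-zero; foldr-map-allFin to sumL-allFin; foldr-map-++ to sumL-++)
  open BigOperator *-commutativeMonoid using ()
    renaming (⨁ to ∏; ⨁-suc to ∏-suc; ⨁-cong to ∏-cong; ⨁-remove to ∏-remove; ⨁-ε to ∏-one;
              foldr-map-allFin to prodL-allFin; foldr-map-++ to prodL-++)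
  open import Algebra.Properties.CommutativeSemigroup +-commutativeSemigroup using () renaming (interchange to +-interchange)
  open import Algebra.Properties.CommutativeSemigroup *-commutativeSemigroup using () renaming (x∙yz≈y∙xz to *-leftComm)
  open import Algebra.Solver.CommutativeMonoid *-commutativeMonoid using (solve; _⊕_; _⊜_)
  open import Relation.Binary.Reasoning.Setoid setoid

  ℕ→C-suc≉0 : ∀ n → ¬ ℕ→C F (suc n) ≈ 0#
  ℕ→C-suc≉0 n = charZero n ∘ trans (sym (ℕ→C≈sucOne n))
    where
    ℕ→C≈sucOne : ∀ n → ℕ→C F (suc n) ≈ sucOne cring n
    ℕ→C≈sucOne zero    = +-identityʳ 1#
    ℕ→C≈sucOne (suc n) = +-congˡ (ℕ→C≈sucOne n)

  fact-nonZero : ∀ n → NonZero (fact F n)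
  fact-nonZero zero    = _
  fact-nonZero (suc n) = ℕₚ.m*n≢0 (suc n) (fact F n) {{_}} {{fact-nonZero n}}

  ℕ→C-fact≉0 : ∀ n → ¬ ℕ→C F (fact F n) ≈ 0#
  ℕ→C-fact≉0 n with fact F n | fact-nonZero n
  ... | suc k | _ = ℕ→C-suc≉0 k

  ⁻¹-cancelˡ : ∀ {x} y → ¬ x ≈ 0# → x ⁻¹ * (x * y) ≈ y
  ⁻¹-cancelˡ {x} y x≉0 = begin
    x ⁻¹ * (x * y) ≈⟨ *-assoc _ _ _ ⟨
    x ⁻¹ * x * y   ≈⟨ *-congʳ (trans (*-comm _ _) (inverseʳ x x≉0)) ⟩
    1# * y         ≈⟨ *-identityˡ y ⟩
    y              ∎

  x≈-x⇒x≈0 : ∀ {x} → x ≈ - x → x ≈ 0#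
  x≈-x⇒x≈0 {x} x≈-x = begin
    x                    ≈⟨ ⁻¹-cancelˡ x (charZero 1) ⟨
    two ⁻¹ * (two * x)   ≈⟨ *-congˡ two*x≈0 ⟩
    two ⁻¹ * 0#          ≈⟨ zeroʳ _ ⟩
    0#                   ∎
    where
    two = 1# + 1#
    two*x≈0 : two * x ≈ 0#
    two*x≈0 = begin
      two * x        ≈⟨ distribʳ x 1# 1# ⟩
      1# * x + 1# * x ≈⟨ +-cong (*-identityˡ x) (*-identityˡ x) ⟩
      x + x           ≈⟨ +-congˡ x≈-x ⟩
      x - x           ≈⟨ -‿inverseʳ x ⟩
      0#              ∎

  ∑L : ∀ {a} {A : Set a} → List A → (A → Carrier) → Carrier
  ∑L xs f = sumL F (map f xs)

  module _ {a} {A : Set a} where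

    ∑L-cong : ∀ (xs : List A) {f g : A → Carrier} → (∀ x → f x ≈ g x) → ∑L xs f ≈ ∑L xs g
    ∑L-cong []       f≈g = refl
    ∑L-cong (x ∷ xs) f≈g = +-cong (f≈g x) (∑L-cong xs f≈g)

    ∑L-congᴬ : ∀ {xs : List A} {f g : A → Carrier} → All (λ x → f x ≈ g x) xs → ∑L xs f ≈ ∑L xs g
    ∑L-congᴬ []             = refl
    ∑L-congᴬ (fx≈gx ∷ f≈g) = +-cong fx≈gx (∑L-congᴬ f≈g)

    *-distribˡ-∑L : ∀ k (xs : List A) (f : A → Carrier) → k * ∑L xs f ≈ ∑L xs (λ x → k * f x)
    *-distribˡ-∑L k []       f = zeroʳ k
    *-distribˡ-∑L k (x ∷ xs) f = trans (distribˡ k _ _) (+-congˡ (*-distribˡ-∑L k xs f))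

    ∑L-const-1 : ∀ (xs : List A) → ∑L xs (λ _ → 1#) ≈ ℕ→C F (length xs)
    ∑L-const-1 []       = refl
    ∑L-const-1 (x ∷ xs) = +-congˡ (∑L-const-1 xs)

    ∑L-filter : ∀ (p : A → Bool) (xs : List A) (f : A → Carrier) →
                ∑L (filterᵇ p xs) f ≈ ∑L xs (λ x → if p x then f x else 0#)
    ∑L-filter p []       f = refl
    ∑L-filter p (x ∷ xs) f with p x
    ... | true  = +-congˡ (∑L-filter p xs f)
    ... | false = trans (∑L-filter p xs f) (sym (+-identityˡ _))

    ∑L-concatMap : ∀ {b} {B : Set b} (g : B → List A) (ys : List B) (f : A → Carrier) →
                   ∑L (concatMap g ys) f ≈ ∑L ys (λ y → ∑L (g y) f)
    ∑L-concatMap g []       f = refl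
    ∑L-concatMap g (y ∷ ys) f = trans (sumL-++ f (g y) _) (+-congˡ (∑L-concatMap g ys f))

  ∑L-map : ∀ {a b} {A : Set a} {B : Set b} (g : A → B) (xs : List A) (f : B → Carrier) → ∑L (map g xs) f ≡ ∑L xs (f ∘ g)
  ∑L-map g []       f = ≡.refl
  ∑L-map g (x ∷ xs) f = ≡.cong (f (g x) +_) (∑L-map g xs f)

  ∑L-concatMap-allFin : ∀ {a} {A B : Set a} n (e : Fin n → A → B) (xs : List A) (f : B → Carrier) →
    ∑L (concatMap (λ k → map (e k) xs) (allFin n)) f ≈ ∑ n (λ k → ∑L xs (f ∘ e k))
  ∑L-concatMap-allFin n e xs f = begin
    ∑L (concatMap (λ k → map (e k) xs) (allFin n)) f ≈⟨ ∑L-concatMap _ (allFin n) f ⟩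
    ∑L (allFin n) (λ k → ∑L (map (e k) xs) f)     ≈⟨ ∑L-cong (allFin n) (λ k → reflexive (∑L-map (e k) xs f)) ⟩
    ∑L (allFin n) (λ k → ∑L xs (f ∘ e k))          ≈⟨ sumL-allFin n _ ⟩
    ∑ n (λ k → ∑L xs (f ∘ e k))                    ∎

  *-distribˡ-∑ : ∀ n x (f : Fin n → Carrier) → x * ∑ n f ≈ ∑ n (λ i → x * f i)
  *-distribˡ-∑ zero    x f = trans (*-congˡ (∑-empty f)) (trans (zeroʳ x) (sym (∑-empty _)))
  *-distribˡ-∑ (suc n) x f = begin
    x * ∑ (suc n) f                    ≈⟨ *-congˡ (∑-suc n f) ⟩
    x * (f zero + ∑ n (f ∘ suc))       ≈⟨ distribˡ x _ _ ⟩
    x * f zero + x * ∑ n (f ∘ suc)     ≈⟨ +-congˡ (*-distribˡ-∑ n x (f ∘ suc)) ⟩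
    x * f zero + ∑ n (λ i → x * f (suc i)) ≈⟨ ∑-suc n _ ⟨
    ∑ (suc n) (λ i → x * f i)          ∎

  -‿∑ : ∀ n (f : Fin n → Carrier) → - ∑ n f ≈ ∑ n (λ i → - f i)
  -‿∑ n f = begin
    - ∑ n f                    ≈⟨ -1*x≈-x _ ⟨
    - 1# * ∑ n f               ≈⟨ *-distribˡ-∑ n (- 1#) f ⟩
    ∑ n (λ i → - 1# * f i)     ≈⟨ ∑-cong n (λ i → -1*x≈-x (f i)) ⟩
    ∑ n (λ i → - f i)          ∎

  -- Expanding the permutation sum

  ρ : Carrier → Carrier → Carrier
  ρ u v = (u + v) * ((u - v) ⁻¹)

  ρ-prod : ∀ {m} → (Fin (suc m) → Carrier) → Fin (suc m) → Carrier
  ρ-prod {m} x k = ∏ m (λ j → ρ (x k) (x (punchIn k j)))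

  Factors : Set c
  Factors = ℕ → Carrier → Carrier

  Pexp : ℕ → Factors → (m : ℕ) → (Fin m → Carrier) → Carrier
  Pexp zero    G m       x = 1#
  Pexp (suc l) G zero    x = 0#
  Pexp (suc l) G (suc m) x = ∑ (suc m) λ k → G 0 (x k) * (ρ-prod x k * Pexp l (G ∘ suc) m (x ∘ punchIn k))

  permFactor : ℕ → Factors → (m : ℕ) → (Fin m → Carrier) → (Fin m → Fin m) → Fin m → Carrier
  permFactor l G m x ω i =
    if toℕ i <ᵇ l
    then G (toℕ i) (x (ω i)) * prodL F (map (λ j → if toℕ i <ᵇ toℕ j then ρ (x (ω i)) (x (ω j)) else 1#) (allFin m))
    else 1#

  permTerm : ℕ → Factors → (m : ℕ) → (Fin m → Carrier) → (Fin m → Fin m) → Carrier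
  permTerm l G m x ω = prodL F (map (permFactor l G m x ω) (allFin m))

  permSum : ℕ → Factors → (m : ℕ) → (Fin m → Carrier) → Carrier
  permSum l G m x = ∑L (perms m) (permTerm l G m x)

  Pgen : ℕ → Factors → (m : ℕ) → (Fin m → Carrier) → Carrier
  Pgen l G m x = if m <ᵇ l then 0# else ℕ→C F (fact F (m ∸ l)) ⁻¹ * permSum l G m x

  Pfun≡Pgen : ∀ λ′ (c : ℕ → Carrier) m x → Pfun F λ′ c m x ≡ Pgen (length λ′) (λ i y → fpow F y c (part λ′ i)) m x
  Pfun≡Pgen λ′ c m x = ≡.refl

  -- The only property of permutations that is used.
  Preserves∏ : ∀ {m} → (Fin m → Fin m) → Set (c ⊔ ℓ)
  Preserves∏ {m} σ = ∀ (h : Fin m → Carrier) → ∏ m (h ∘ σ) ≈ ∏ m h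

  extension-preserves∏ : ∀ {m} k {σ : Fin m → Fin m} {ω : Fin (suc m) → Fin (suc m)} →
    ω zero ≡ k → (∀ i → ω (suc i) ≡ punchIn k (σ i)) → Preserves∏ σ → Preserves∏ ω
  extension-preserves∏ {m} k {σ} {ω} ω0≡k ω∘suc≡ σ-pres h = begin
    ∏ (suc m) (h ∘ ω)                  ≈⟨ ∏-suc m _ ⟩
    h (ω zero) * ∏ m (h ∘ ω ∘ suc)     ≈⟨ *-cong (reflexive (≡.cong h ω0≡k)) (∏-cong m (reflexive ∘ ≡.cong h ∘ ω∘suc≡)) ⟩
    h k * ∏ m (h ∘ punchIn k ∘ σ)      ≈⟨ *-congˡ (σ-pres (h ∘ punchIn k)) ⟩
    h k * ∏ m (h ∘ punchIn k)          ≈⟨ ∏-remove m h k ⟨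
    ∏ (suc m) h                        ∎

  -- The extension map σ ↦ (0 ↦ k, suc i ↦ punchIn k (σ i)) is local to Defs.perms and cannot be
  -- named here; it is recovered by unification, together with its defining equations.
  record PermsDecomposition (m : ℕ) : Set where
    field
      extend      : Fin (suc m) → (Fin m → Fin m) → Fin (suc m) → Fin (suc m)
      perms-suc   : perms (suc m) ≡ concatMap (λ k → map (extend k) (perms m)) (allFin (suc m))
      extend-zero : ∀ k σ → extend k σ zero ≡ k
      extend-suc  : ∀ k σ i → extend k σ (suc i) ≡ punchIn k (σ i)

  perms-decomposition : ∀ m → PermsDecomposition m
  perms-decomposition m = record
    { extend = _ ; perms-suc = ≡.refl ; extend-zero = λ _ _ → ≡.refl ; extend-suc = λ _ _ _ → ≡.refl }

  perms-preserve∏ : ∀ m → All Preserves∏ (perms m)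
  perms-preserve∏ zero    = (λ h → refl) ∷ []
  perms-preserve∏ (suc m) = ≡.subst (All Preserves∏) (≡.sym perms-suc) (concat⁺ (map⁺ (tabulate⁺ λ k →
    map⁺ (All.map (λ {σ} → extension-preserves∏ k {σ} {extend k σ} (extend-zero k σ) (extend-suc k σ)) (perms-preserve∏ m)))))
    where open PermsDecomposition (perms-decomposition m)

  length-concatMap-map : ∀ {a b} {A : Set a} {B B′ : Set b} (e : A → B → B′) (xs : List A) (ys : List B) →
                         length (concatMap (λ x → map (e x) ys) xs) ≡ length xs ℕ.* length ys
  length-concatMap-map e []       ys = ≡.refl
  length-concatMap-map e (x ∷ xs) ys =
    ≡.trans (length-++ (map (e x) ys)) (≡.cong₂ ℕ._+_ (length-map (e x) ys) (length-concatMap-map e xs ys))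

  length-perms : ∀ m → length (perms m) ≡ fact F m
  length-perms zero    = ≡.refl
  length-perms (suc m) = ≡.trans (≡.cong length perms-suc) (≡.trans (length-concatMap-map extend (allFin (suc m)) (perms m))
                                 (≡.cong₂ ℕ._*_ (length-tabulate {n = suc m} id) (length-perms m)))
    where open PermsDecomposition (perms-decomposition m)

  permTerm-extend : ∀ l G m (x : Fin (suc m) → Carrier) k {σ ω} →
    ω zero ≡ k → (∀ i → ω (suc i) ≡ punchIn k (σ i)) → Preserves∏ σ →
    permTerm (suc l) G (suc m) x ω ≈ G 0 (x k) * (ρ-prod x k * permTerm l (G ∘ suc) m (x ∘ punchIn k) σ)
  permTerm-extend l G m x k {σ} {ω} ω0≡k ω∘suc≡ σ-pres = begin
    permTerm (suc l) G (suc m) x ω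
      ≈⟨ trans (prodL-allFin (suc m) _) (∏-suc m _) ⟩
    permFactor (suc l) G (suc m) x ω zero * ∏ m (permFactor (suc l) G (suc m) x ω ∘ suc)
      ≈⟨ *-cong (*-cong (reflexive (≡.cong (G 0 ∘ x) ω0≡k)) first-row) other-rows ⟩
    G 0 (x k) * ρ-prod x k * permTerm l (G ∘ suc) m (x ∘ punchIn k) σ
      ≈⟨ *-assoc _ _ _ ⟩
    G 0 (x k) * (ρ-prod x k * permTerm l (G ∘ suc) m (x ∘ punchIn k) σ) ∎
    where
    xω≡ : ∀ i → x (ω (suc i)) ≡ x (punchIn k (σ i))
    xω≡ = ≡.cong x ∘ ω∘suc≡

    first-row : prodL F (map (λ j → if 0 <ᵇ toℕ j then ρ (x (ω zero)) (x (ω j)) else 1#) (allFin (suc m))) ≈ ρ-prod x k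
    first-row = begin
      _                                                ≈⟨ trans (prodL-allFin (suc m) _) (∏-suc m _) ⟩
      1# * ∏ m (λ j → ρ (x (ω zero)) (x (ω (suc j))))   ≈⟨ *-identityˡ _ ⟩
      ∏ m (λ j → ρ (x (ω zero)) (x (ω (suc j))))        ≈⟨ ∏-cong m (λ j → reflexive (≡.cong₂ ρ (≡.cong x ω0≡k) (xω≡ j))) ⟩
      ∏ m (λ j → ρ (x k) (x (punchIn k (σ j))))          ≈⟨ σ-pres _ ⟩
      ρ-prod x k                                         ∎

    row : ∀ i → permFactor (suc l) G (suc m) x ω (suc i) ≈ permFactor l (G ∘ suc) m (x ∘ punchIn k) σ i
    row i with toℕ i <ᵇ l
    ... | false = refl
    ... | true  = *-cong (reflexive (≡.cong (G (suc (toℕ i))) (xω≡ i))) (begin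
      _      ≈⟨ trans (prodL-allFin (suc m) _) (∏-suc m _) ⟩
      1# * _ ≈⟨ *-identityˡ _ ⟩
      _      ≈⟨ ∏-cong m (λ j → reflexive (≡.cong₂ (λ u v → if toℕ i <ᵇ toℕ j then ρ u v else 1#) (xω≡ i) (xω≡ j))) ⟩
      _      ≈⟨ prodL-allFin m _ ⟨
      _      ∎)

    other-rows : ∏ m (permFactor (suc l) G (suc m) x ω ∘ suc) ≈ permTerm l (G ∘ suc) m (x ∘ punchIn k) σ
    other-rows = trans (∏-cong m row) (sym (prodL-allFin m _))

  permSum-suc : ∀ l G m x →
    permSum (suc l) G (suc m) x ≈ ∑ (suc m) (λ k → G 0 (x k) * (ρ-prod x k * permSum l (G ∘ suc) m (x ∘ punchIn k)))
  permSum-suc l G m x = begin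
    permSum (suc l) G (suc m) x
      ≡⟨ ≡.cong (λ ps → ∑L ps (permTerm (suc l) G (suc m) x)) perms-suc ⟩
    ∑L (concatMap (λ k → map (extend k) (perms m)) (allFin (suc m))) (permTerm (suc l) G (suc m) x)
      ≈⟨ ∑L-concatMap-allFin (suc m) extend (perms m) _ ⟩
    ∑ (suc m) (λ k → ∑L (perms m) (permTerm (suc l) G (suc m) x ∘ extend k))
      ≈⟨ ∑-cong (suc m) (λ k → ∑L-congᴬ (All.map (λ {σ} → permTerm-extend l G m x k {σ} {extend k σ}
                                              (extend-zero k σ) (extend-suc k σ)) (perms-preserve∏ m))) ⟩
    ∑ (suc m) (λ k → ∑L (perms m) (λ σ → G 0 (x k) * (ρ-prod x k * permTerm l (G ∘ suc) m (x ∘ punchIn k) σ)))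
      ≈⟨ ∑-cong (suc m) (λ k → trans (*-distribˡ-∑L _ (perms m) _) (∑L-cong (perms m) (λ σ → *-assoc _ _ _))) ⟨
    ∑ (suc m) (λ k → G 0 (x k) * ρ-prod x k * permSum l (G ∘ suc) m (x ∘ punchIn k))
      ≈⟨ ∑-cong (suc m) (λ k → *-assoc _ _ _) ⟩
    ∑ (suc m) (λ k → G 0 (x k) * (ρ-prod x k * permSum l (G ∘ suc) m (x ∘ punchIn k))) ∎
    where open PermsDecomposition (perms-decomposition m)

  permSum-zero : ∀ G m x → permSum 0 G m x ≈ ℕ→C F (fact F m)
  permSum-zero G m x = begin
    ∑L (perms m) (λ _ → prodL F (map (λ _ → 1#) (allFin m))) ≈⟨ ∑L-cong (perms m) (λ _ → ones) ⟩
    ∑L (perms m) (λ _ → 1#)                                   ≈⟨ ∑L-const-1 (perms m) ⟩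
    ℕ→C F (length (perms m))                                  ≡⟨ ≡.cong (ℕ→C F) (length-perms m) ⟩
    ℕ→C F (fact F m)                                          ∎
    where
    ones : prodL F (map (λ _ → 1#) (allFin m)) ≈ 1#
    ones = trans (prodL-allFin m _) (∏-one m (λ _ → refl))

  Pexp-vanishes : ∀ l G m x → m < l → Pexp l G m x ≈ 0#
  Pexp-vanishes (suc l) G zero    x _          = refl
  Pexp-vanishes (suc l) G (suc m) x (s≤s m<l) = ∑-zero (suc m) λ k →
    trans (*-congˡ (trans (*-congˡ (Pexp-vanishes l _ m _ m<l)) (zeroʳ _))) (zeroʳ _)

  permSum≈fact*Pexp : ∀ l G m x → l ≤ m → permSum l G m x ≈ ℕ→C F (fact F (m ∸ l)) * Pexp l G m x
  permSum≈fact*Pexp zero    G m       x _         = trans (permSum-zero G m x) (sym (*-identityʳ _))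
  permSum≈fact*Pexp (suc l) G (suc m) x (s≤s l≤m) = begin
    permSum (suc l) G (suc m) x
      ≈⟨ permSum-suc l G m x ⟩
    ∑ (suc m) (λ k → G 0 (x k) * (ρ-prod x k * permSum l (G ∘ suc) m (x ∘ punchIn k)))
      ≈⟨ ∑-cong (suc m) (λ k → *-congˡ (*-congˡ (permSum≈fact*Pexp l (G ∘ suc) m (x ∘ punchIn k) l≤m))) ⟩
    ∑ (suc m) (λ k → G 0 (x k) * (ρ-prod x k * (f * Pexp l (G ∘ suc) m (x ∘ punchIn k))))
      ≈⟨ ∑-cong (suc m) (λ k → trans (*-congˡ (*-leftComm _ f _)) (*-leftComm _ f _)) ⟩
    ∑ (suc m) (λ k → f * (G 0 (x k) * (ρ-prod x k * Pexp l (G ∘ suc) m (x ∘ punchIn k))))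
      ≈⟨ *-distribˡ-∑ (suc m) f _ ⟨
    f * Pexp (suc l) G (suc m) x ∎
    where
    f = ℕ→C F (fact F (m ∸ l))

  Pgen≈Pexp : ∀ l G m x → Pgen l G m x ≈ Pexp l G m x
  Pgen≈Pexp l G m x with m <ᵇ l in m<ᵇl
  ... | true  = sym (Pexp-vanishes l G m x (ℕₚ.<ᵇ⇒< m l (≡.subst T (≡.sym m<ᵇl) _)))
  ... | false = trans (*-congˡ (permSum≈fact*Pexp l G m x l≤m)) (⁻¹-cancelˡ _ (ℕ→C-fact≉0 (m ∸ l)))
    where
    l≤m : l ≤ m
    l≤m = ℕₚ.≮⇒≥ (λ m<l → ≡.subst T m<ᵇl (ℕₚ.<⇒<ᵇ m<l))

  -- Alternation

  Pexp-cong : ∀ l {G G′ : Factors} m {x y : Fin m → Carrier} →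
              (∀ i u → G i u ≡ G′ i u) → (∀ i → x i ≡ y i) → Pexp l G m x ≈ Pexp l G′ m y
  Pexp-cong zero    m       G≡G′ x≡y = refl
  Pexp-cong (suc l) zero    G≡G′ x≡y = refl
  Pexp-cong (suc l) {G} (suc m) G≡G′ x≡y = ∑-cong (suc m) λ k →
    *-cong (reflexive (≡.trans (≡.cong (G 0) (x≡y k)) (G≡G′ 0 _)))
           (*-cong (∏-cong m (λ j → reflexive (≡.cong₂ ρ (x≡y k) (x≡y (punchIn k j)))))
                   (Pexp-cong l m (G≡G′ ∘ suc) (x≡y ∘ punchIn k)))

  Distinct : ∀ {m} → (Fin m → Carrier) → Set ℓ
  Distinct x = ∀ i j → ¬ i ≡ j → ¬ x i ≈ x j

  Distinct-punchIn : ∀ {m} {x : Fin (suc m) → Carrier} k → Distinct x → Distinct (x ∘ punchIn k)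
  Distinct-punchIn k x-distinct i j i≢j = x-distinct _ _ (i≢j ∘ punchIn-injective k i j)

  -[a]*-[b]≈a*b : ∀ a b → - a * - b ≈ a * b
  -[a]*-[b]≈a*b a b = trans (sym (-‿distribˡ-* a (- b))) (trans (-‿cong (sym (-‿distribʳ-* a b))) (-‿involutive _))

  ρ-antisym : ∀ {u v} → ¬ u ≈ v → ρ v u ≈ - ρ u v
  ρ-antisym {u} {v} u≉v = begin
    (v + u) * (v - u) ⁻¹       ≈⟨ *-cong (+-comm v u) inverse ⟩
    (u + v) * - ((u - v) ⁻¹)   ≈⟨ -‿distribʳ-* _ _ ⟨
    - ρ u v                    ∎
    where
    v-u≈-[u-v] : v - u ≈ - (u - v)
    v-u≈-[u-v] = sym (⁻¹-anti-homo‿- u v)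
    u-v≉0 : ¬ u - v ≈ 0#
    u-v≉0 = u≉v ∘ x∙y⁻¹≈ε⇒x≈y u v
    v-u≉0 : ¬ v - u ≈ 0#
    v-u≉0 v-u≈0 = u-v≉0 (begin
      u - v         ≈⟨ -‿involutive _ ⟨
      - - (u - v)   ≈⟨ -‿cong (trans (sym v-u≈-[u-v]) v-u≈0) ⟩
      - 0#          ≈⟨ -0#≈0# ⟩
      0#            ∎)
    inverse : (v - u) ⁻¹ ≈ - ((u - v) ⁻¹)
    inverse = begin
      (v - u) ⁻¹                                  ≈⟨ *-identityʳ _ ⟨
      (v - u) ⁻¹ * 1#                              ≈⟨ *-congˡ (inverseʳ _ u-v≉0) ⟨
      (v - u) ⁻¹ * ((u - v) * (u - v) ⁻¹)           ≈⟨ *-congˡ (-[a]*-[b]≈a*b _ _) ⟨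
      (v - u) ⁻¹ * (- (u - v) * - ((u - v) ⁻¹))     ≈⟨ *-congˡ (*-congʳ v-u≈-[u-v]) ⟨
      (v - u) ⁻¹ * ((v - u) * - ((u - v) ⁻¹))       ≈⟨ ⁻¹-cancelˡ _ v-u≉0 ⟩
      - ((u - v) ⁻¹)                               ∎

  adjSwap : ℕ → ℕ → ℕ
  adjSwap zero    zero          = 1
  adjSwap zero    (suc zero)    = 0
  adjSwap zero    (suc (suc i)) = suc (suc i)
  adjSwap (suc p) zero          = zero
  adjSwap (suc p) (suc i)       = suc (adjSwap p i)

  punchIn-punchIn-sym : ∀ {n} {k j : Fin (suc (suc n))} (k≢j : ¬ k ≡ j) (j≢k : ¬ j ≡ k) i →
                        punchIn k (punchIn (punchOut k≢j) i) ≡ punchIn j (punchIn (punchOut j≢k) i)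
  punchIn-punchIn-sym {n}     {zero}  {zero}  k≢j j≢k i       = ⊥-elim (k≢j ≡.refl)
  punchIn-punchIn-sym {n}     {zero}  {suc j} k≢j j≢k i       = ≡.refl
  punchIn-punchIn-sym {n}     {suc k} {zero}  k≢j j≢k i       = ≡.refl
  punchIn-punchIn-sym {suc n} {suc k} {suc j} k≢j j≢k zero    = ≡.refl
  punchIn-punchIn-sym {suc n} {suc k} {suc j} k≢j j≢k (suc i) =
    ≡.cong suc (punchIn-punchIn-sym (k≢j ∘ ≡.cong suc) (j≢k ∘ ≡.cong suc) i)

  -- Expanding twice, Pexp is a sum over ordered pairs k ≠ j of points receiving the first two factors;
  -- exchanging these factors amounts to exchanging k and j, which only flips the sign of ρ (x k) (x j).
  module PairExpansion (l n : ℕ) (x : Fin (suc (suc n)) → Carrier) where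

    ρ-rest : Fin (suc (suc n)) → (Fin n → Fin (suc (suc n))) → Carrier
    ρ-rest u ι = ∏ n (λ i → ρ (x u) (x (ι i)))

    pairTerm′ : Factors → (k j : Fin (suc (suc n))) → Fin (suc n) → Carrier
    pairTerm′ G k j q = G 0 (x k) * G 1 (x j) * (ρ (x k) (x j) * (ρ-rest k ι * (ρ-rest j ι * Pexp l (λ i → G (suc (suc i))) n (x ∘ ι))))
      where ι = punchIn k ∘ punchIn q

    pairTerm : Factors → (k j : Fin (suc (suc n))) → Carrier
    pairTerm G k j with k ≟ j
    ... | yes _   = 0#
    ... | no k≢j  = pairTerm′ G k j (punchOut k≢j)

    pairTerm-diag : ∀ G k → pairTerm G k k ≈ 0#
    pairTerm-diag G k with k ≟ k
    ... | yes _   = refl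
    ... | no k≢k  = ⊥-elim (k≢k ≡.refl)

    pairTerm-punchIn : ∀ G k q → pairTerm G k (punchIn k q) ≈ pairTerm′ G k (punchIn k q) q
    pairTerm-punchIn G k q with k ≟ punchIn k q
    ... | yes k≡ = ⊥-elim (punchInᵢ≢i k q (≡.sym k≡))
    ... | no k≢  = reflexive (≡.cong (pairTerm′ G k (punchIn k q)) (≡.trans (punchOut-cong k ≡.refl) (punchOut-punchIn k)))

    Pexp≈∑∑pairTerm : ∀ G → Pexp (suc (suc l)) G (suc (suc n)) x ≈ ∑ (suc (suc n)) (λ k → ∑ (suc (suc n)) (pairTerm G k))
    Pexp≈∑∑pairTerm G = ∑-cong (suc (suc n)) λ k → begin
      G 0 (x k) * (ρ-prod x k * ∑ (suc n) (λ q → G 1 (x (punchIn k q)) * (ρ-prod (x ∘ punchIn k) q * R k q)))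
        ≈⟨ trans (*-congˡ (*-distribˡ-∑ _ _ _)) (*-distribˡ-∑ _ _ _) ⟩
      ∑ (suc n) (λ q → G 0 (x k) * (ρ-prod x k * (G 1 (x (punchIn k q)) * (ρ-prod (x ∘ punchIn k) q * R k q))))
        ≈⟨ ∑-cong (suc n) (λ q → trans (*-congˡ (*-congʳ (∏-remove n _ q))) (rearrange _ _ _ _ _ _)) ⟩
      ∑ (suc n) (λ q → pairTerm′ G k (punchIn k q) q)
        ≈⟨ ∑-cong (suc n) (λ q → sym (pairTerm-punchIn G k q)) ⟩
      ∑ (suc n) (pairTerm G k ∘ punchIn k)
        ≈⟨ +-identityˡ _ ⟨
      0# + ∑ (suc n) (pairTerm G k ∘ punchIn k)
        ≈⟨ +-congʳ (pairTerm-diag G k) ⟨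
      pairTerm G k k + ∑ (suc n) (pairTerm G k ∘ punchIn k)
        ≈⟨ ∑-remove (suc n) (pairTerm G k) k ⟨
      ∑ (suc (suc n)) (pairTerm G k) ∎
      where
      R : Fin (suc (suc n)) → Fin (suc n) → Carrier
      R k q = Pexp l (λ i → G (suc (suc i))) n (x ∘ punchIn k ∘ punchIn q)
      rearrange : ∀ a r A b B P → a * ((r * A) * (b * (B * P))) ≈ a * b * (r * (A * (B * P)))
      rearrange = solve 6 (λ a r A b B P → a ⊕ ((r ⊕ A) ⊕ (b ⊕ (B ⊕ P))) ⊜ (a ⊕ b) ⊕ (r ⊕ (A ⊕ (B ⊕ P)))) refl

    pairTerm-swap : ∀ G → Distinct x → ∀ k j → pairTerm (G ∘ adjSwap 0) k j ≈ - pairTerm G j k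
    pairTerm-swap G x-distinct k j with k ≟ j | j ≟ k
    ... | yes _   | yes _   = sym -0#≈0#
    ... | yes k≡j | no j≢k  = ⊥-elim (j≢k (≡.sym k≡j))
    ... | no k≢j  | yes j≡k = ⊥-elim (k≢j (≡.sym j≡k))
    ... | no k≢j  | no j≢k  = begin
      G 1 (x k) * G 0 (x j) * (ρ (x k) (x j) * (ρ-rest k ι * (ρ-rest j ι * P)))
        ≈⟨ *-congˡ (*-cong (ρ-antisym (x-distinct j k j≢k)) (*-cong (ρ-rest-cong k) (*-cong (ρ-rest-cong j) P≈P′))) ⟩
      G 1 (x k) * G 0 (x j) * (- ρ (x j) (x k) * (ρ-rest k ι′ * (ρ-rest j ι′ * P′)))
        ≈⟨ trans (*-congˡ (sym (-‿distribˡ-* _ _))) (sym (-‿distribʳ-* _ _)) ⟩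
      - (G 1 (x k) * G 0 (x j) * (ρ (x j) (x k) * (ρ-rest k ι′ * (ρ-rest j ι′ * P′))))
        ≈⟨ -‿cong (rearrange _ _ _ _ _ _) ⟩
      - (G 0 (x j) * G 1 (x k) * (ρ (x j) (x k) * (ρ-rest j ι′ * (ρ-rest k ι′ * P′)))) ∎
      where
      ι  = punchIn k ∘ punchIn (punchOut k≢j)
      ι′ = punchIn j ∘ punchIn (punchOut j≢k)
      P  = Pexp l (λ i → G (suc (suc i))) n (x ∘ ι)
      P′ = Pexp l (λ i → G (suc (suc i))) n (x ∘ ι′)
      ρ-rest-cong : ∀ u → ρ-rest u ι ≈ ρ-rest u ι′
      ρ-rest-cong u = ∏-cong n (λ i → reflexive (≡.cong (ρ (x u) ∘ x) (punchIn-punchIn-sym k≢j j≢k i)))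
      P≈P′ : P ≈ P′
      P≈P′ = Pexp-cong l n (λ _ _ → ≡.refl) (≡.cong x ∘ punchIn-punchIn-sym k≢j j≢k)
      rearrange : ∀ a b r A B Q → a * b * (r * (A * (B * Q))) ≈ b * a * (r * (B * (A * Q)))
      rearrange = solve 6 (λ a b r A B Q → (a ⊕ b) ⊕ (r ⊕ (A ⊕ (B ⊕ Q))) ⊜ (b ⊕ a) ⊕ (r ⊕ (B ⊕ (A ⊕ Q)))) refl

  Pexp-swap : ∀ p l G m (x : Fin m → Carrier) → Distinct x → suc p < l → Pexp l (G ∘ adjSwap p) m x ≈ - Pexp l G m x
  Pexp-swap zero (suc zero)    G m             x _ (s≤s ())
  Pexp-swap zero (suc (suc l)) G zero          x _ _ = sym -0#≈0#
  Pexp-swap zero (suc (suc l)) G (suc zero)    x _ _ = begin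
    Pexp (suc (suc l)) (G ∘ adjSwap 0) 1 x   ≈⟨ Pexp-vanishes (suc (suc l)) (G ∘ adjSwap 0) 1 x (s≤s (s≤s z≤n)) ⟩
    0#                                       ≈⟨ -0#≈0# ⟨
    - 0#                                     ≈⟨ -‿cong (Pexp-vanishes (suc (suc l)) G 1 x (s≤s (s≤s z≤n))) ⟨
    - Pexp (suc (suc l)) G 1 x               ∎
  Pexp-swap zero (suc (suc l)) G (suc (suc n)) x x-distinct _ = begin
    Pexp (suc (suc l)) (G ∘ adjSwap 0) (suc (suc n)) x       ≈⟨ Pexp≈∑∑pairTerm (G ∘ adjSwap 0) ⟩
    ∑ (suc (suc n)) (λ k → ∑ (suc (suc n)) (λ j → pairTerm (G ∘ adjSwap 0) k j))
      ≈⟨ ∑-cong (suc (suc n)) (λ k → ∑-cong (suc (suc n)) (pairTerm-swap G x-distinct k)) ⟩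
    ∑ (suc (suc n)) (λ k → ∑ (suc (suc n)) (λ j → - pairTerm G j k)) ≈⟨ ∑-comm (suc (suc n)) (suc (suc n)) _ ⟩
    ∑ (suc (suc n)) (λ j → ∑ (suc (suc n)) (λ k → - pairTerm G j k)) ≈⟨ ∑-cong (suc (suc n)) (λ j → -‿∑ (suc (suc n)) _) ⟨
    ∑ (suc (suc n)) (λ j → - ∑ (suc (suc n)) (pairTerm G j))       ≈⟨ -‿∑ (suc (suc n)) _ ⟨
    - ∑ (suc (suc n)) (λ j → ∑ (suc (suc n)) (pairTerm G j))       ≈⟨ -‿cong (Pexp≈∑∑pairTerm G) ⟨
    - Pexp (suc (suc l)) G (suc (suc n)) x                          ∎
    where open PairExpansion l n x
  Pexp-swap (suc p) (suc l) G zero    x _          _           = sym -0#≈0#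
  Pexp-swap (suc p) (suc l) G (suc m) x x-distinct (s≤s p<l) = begin
    ∑ (suc m) (λ k → G 0 (x k) * (ρ-prod x k * Pexp l (G ∘ suc ∘ adjSwap p) m (x ∘ punchIn k)))
      ≈⟨ ∑-cong (suc m) (λ k → *-congˡ (*-congˡ (Pexp-swap p l (G ∘ suc) m _ (Distinct-punchIn k x-distinct) p<l))) ⟩
    ∑ (suc m) (λ k → G 0 (x k) * (ρ-prod x k * - Pexp l (G ∘ suc) m (x ∘ punchIn k)))
      ≈⟨ ∑-cong (suc m) (λ k → trans (*-congˡ (sym (-‿distribʳ-* _ _))) (sym (-‿distribʳ-* _ _))) ⟩
    ∑ (suc m) (λ k → - (G 0 (x k) * (ρ-prod x k * Pexp l (G ∘ suc) m (x ∘ punchIn k))))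
      ≈⟨ -‿∑ (suc m) _ ⟨
    - Pexp (suc l) G (suc m) x ∎

  -- Super complete homogeneous functions

  infix 4 _≐_
  _≐_ : Series F → Series F → Set ℓ
  f ≐ g = ∀ k → f k ≈ g k

  ≐-trans : ∀ {f g h} → f ≐ g → g ≐ h → f ≐ h
  ≐-trans f≐g g≐h k = trans (f≐g k) (g≐h k)

  ≐-sym : ∀ {f g} → f ≐ g → g ≐ f
  ≐-sym f≐g k = sym (f≐g k)

  infixl 7 _⋆_
  _⋆_ : Series F → Series F → Series F
  _⋆_ = _⊛_ F

  sumTo-cong : ∀ k {f g : ℕ → Carrier} → (∀ i → f i ≈ g i) → sumTo F k f ≈ sumTo F k g
  sumTo-cong zero    f≈g = f≈g 0
  sumTo-cong (suc k) f≈g = +-cong (sumTo-cong k f≈g) (f≈g (suc k))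

  sumTo-suc : ∀ k (f : ℕ → Carrier) → sumTo F (suc k) f ≈ f 0 + sumTo F k (f ∘ suc)
  sumTo-suc zero    f = refl
  sumTo-suc (suc k) f = trans (+-congʳ (sumTo-suc k f)) (+-assoc _ _ _)

  sumTo-zero : ∀ k {f : ℕ → Carrier} → (∀ i → f i ≈ 0#) → sumTo F k f ≈ 0#
  sumTo-zero zero    f≈0 = f≈0 0
  sumTo-zero (suc k) f≈0 = trans (+-cong (sumTo-zero k f≈0) (f≈0 (suc k))) (+-identityˡ 0#)

  *-distribˡ-sumTo : ∀ k x (f : ℕ → Carrier) → x * sumTo F k f ≈ sumTo F k (λ i → x * f i)
  *-distribˡ-sumTo zero    x f = refl
  *-distribˡ-sumTo (suc k) x f = trans (distribˡ x _ _) (+-congʳ (*-distribˡ-sumTo k x f))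

  sumTo-distrib-+ : ∀ k (f g : ℕ → Carrier) → sumTo F k (λ i → f i + g i) ≈ sumTo F k f + sumTo F k g
  sumTo-distrib-+ zero    f g = refl
  sumTo-distrib-+ (suc k) f g = trans (+-congʳ (sumTo-distrib-+ k f g)) (+-interchange _ _ _ _)

  ⋆-congʳ : ∀ f {g g′} → g ≐ g′ → f ⋆ g ≐ f ⋆ g′
  ⋆-congʳ f g≐g′ k = sumTo-cong k (λ i → *-congˡ (g≐g′ (k ∸ i)))

  ⋆-suc : ∀ f g k → (f ⋆ g) (suc k) ≈ f 0 * g (suc k) + sumTo F k (λ i → f (suc i) * g (k ∸ i))
  ⋆-suc f g k = sumTo-suc k _

  linMul : Carrier → Series F → Series F
  linMul z f zero    = f zero
  linMul z f (suc k) = f (suc k) + z * f k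

  geomMul : Carrier → Series F → Series F
  geomMul y f zero    = f zero
  geomMul y f (suc k) = f (suc k) + y * geomMul y f k

  linMul-cong : ∀ z {f g} → f ≐ g → linMul z f ≐ linMul z g
  linMul-cong z f≐g zero    = f≐g 0
  linMul-cong z f≐g (suc k) = +-cong (f≐g (suc k)) (*-congˡ (f≐g k))

  geomMul-cong : ∀ y {f g} → f ≐ g → geomMul y f ≐ geomMul y g
  geomMul-cong y f≐g zero    = f≐g 0
  geomMul-cong y f≐g (suc k) = +-cong (f≐g (suc k)) (*-congˡ (geomMul-cong y f≐g k))

  oneS-⋆ : ∀ g → oneS F ⋆ g ≐ g
  oneS-⋆ g zero    = *-identityˡ _
  oneS-⋆ g (suc k) = trans (⋆-suc (oneS F) g k) (trans (+-cong (*-identityˡ _) (sumTo-zero k (λ i → zeroˡ _))) (+-identityʳ _))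

  linS-⋆ : ∀ z g → linS F z ⋆ g ≐ linMul z g
  linS-⋆ z g zero          = *-identityˡ _
  linS-⋆ z g (suc zero)    = +-congʳ (*-identityˡ _)
  linS-⋆ z g (suc (suc k)) = trans (⋆-suc (linS F z) g (suc k))
    (+-cong (*-identityˡ _) (trans (sumTo-suc k _) (trans (+-congˡ (sumTo-zero k (λ i → zeroˡ _))) (+-identityʳ _))))

  geomS-⋆ : ∀ y g → geomS F y ⋆ g ≐ geomMul y g
  geomS-⋆ y g zero    = *-identityˡ _
  geomS-⋆ y g (suc k) = trans (⋆-suc (geomS F y) g k) (+-cong (*-identityˡ _) (begin
    sumTo F k (λ i → y * pow F y i * g (k ∸ i))   ≈⟨ sumTo-cong k (λ i → *-assoc _ _ _) ⟩
    sumTo F k (λ i → y * (pow F y i * g (k ∸ i))) ≈⟨ *-distribˡ-sumTo k y _ ⟨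
    y * (geomS F y ⋆ g) k                         ≈⟨ *-congˡ (geomS-⋆ y g k) ⟩
    y * geomMul y g k                             ∎))

  linS-⋆-assoc : ∀ z g h → (linS F z ⋆ g) ⋆ h ≐ linMul z (g ⋆ h)
  linS-⋆-assoc z g h zero    = *-congʳ (linS-⋆ z g 0)
  linS-⋆-assoc z g h (suc k) = begin
    ((linS F z ⋆ g) ⋆ h) (suc k)
      ≈⟨ ⋆-suc _ h k ⟩
    (linS F z ⋆ g) 0 * h (suc k) + sumTo F k (λ i → (linS F z ⋆ g) (suc i) * h (k ∸ i))
      ≈⟨ +-cong (*-congʳ (linS-⋆ z g 0)) (sumTo-cong k (λ i → *-congʳ (linS-⋆ z g (suc i)))) ⟩
    g 0 * h (suc k) + sumTo F k (λ i → (g (suc i) + z * g i) * h (k ∸ i))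
      ≈⟨ +-congˡ (trans (sumTo-cong k (λ i → trans (distribʳ _ _ _) (+-congˡ (*-assoc _ _ _)))) (sumTo-distrib-+ k _ _)) ⟩
    g 0 * h (suc k) + (sumTo F k (λ i → g (suc i) * h (k ∸ i)) + sumTo F k (λ i → z * (g i * h (k ∸ i))))
      ≈⟨ +-assoc _ _ _ ⟨
    (g 0 * h (suc k) + sumTo F k (λ i → g (suc i) * h (k ∸ i))) + sumTo F k (λ i → z * (g i * h (k ∸ i)))
      ≈⟨ +-cong (⋆-suc g h k) (*-distribˡ-sumTo k z _) ⟨
    linMul z (g ⋆ h) (suc k) ∎

  exchange : ∀ a b c d y z → (a + y * b) + z * (c + y * d) ≈ (a + z * c) + y * (b + z * d)
  exchange a b c d y z = begin
    (a + y * b) + z * (c + y * d)       ≈⟨ +-congˡ (trans (distribˡ z c _) (+-congˡ (*-leftComm z y d))) ⟩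
    (a + y * b) + (z * c + y * (z * d)) ≈⟨ +-interchange _ _ _ _ ⟩
    (a + z * c) + (y * b + y * (z * d)) ≈⟨ +-congˡ (distribˡ y b _) ⟨
    (a + z * c) + y * (b + z * d)       ∎

  linMul-comm : ∀ z w f → linMul z (linMul w f) ≐ linMul w (linMul z f)
  linMul-comm z w f zero          = refl
  linMul-comm z w f (suc zero)    = trans (+-assoc _ _ _) (trans (+-congˡ (+-comm _ _)) (sym (+-assoc _ _ _)))
  linMul-comm z w f (suc (suc k)) = exchange _ _ _ _ w z

  linMul-geomMul : ∀ z y f → linMul z (geomMul y f) ≐ geomMul y (linMul z f)
  linMul-geomMul z y f zero          = refl
  linMul-geomMul z y f (suc zero)    = trans (+-assoc _ _ _) (trans (+-congˡ (+-comm _ _)) (sym (+-assoc _ _ _)))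
  linMul-geomMul z y f (suc (suc k)) = trans (exchange _ _ _ _ y z) (+-congˡ (*-congˡ (linMul-geomMul z y f (suc k))))

  cancel : ∀ a y b → (a + - y * b) + y * b ≈ a
  cancel a y b = begin
    (a + - y * b) + y * b  ≈⟨ +-assoc _ _ _ ⟩
    a + (- y * b + y * b)  ≈⟨ +-congˡ (trans (sym (distribʳ b _ _)) (trans (*-congʳ (-‿inverseˡ y)) (zeroˡ b))) ⟩
    a + 0#                 ≈⟨ +-identityʳ a ⟩
    a                      ∎

  geomMul-linMul⁻ : ∀ y f → geomMul y (linMul (- y) f) ≐ f
  geomMul-linMul⁻ y f zero    = refl
  geomMul-linMul⁻ y f (suc k) = trans (+-congˡ (*-congˡ (geomMul-linMul⁻ y f k))) (cancel _ y _)

  linMul⁻-geomMul : ∀ y f → linMul (- y) (geomMul y f) ≐ f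
  linMul⁻-geomMul y f zero    = refl
  linMul⁻-geomMul y f (suc k) = trans (+-congʳ (+-congˡ (*-congʳ (sym (-‿involutive y))))) (cancel _ (- y) _)

  -- geomMul y is the inverse of linMul (- y), so commutation follows from that of the linMul.
  geomMul-comm : ∀ y w f → geomMul y (geomMul w f) ≐ geomMul w (geomMul y f)
  geomMul-comm y w f =
    ≐-trans (≐-sym (geomMul-linMul⁻ w h))
    (≐-trans (geomMul-cong w (≐-sym (geomMul-linMul⁻ y (linMul (- w) h))))
    (≐-trans (geomMul-cong w (geomMul-cong y (linMul-comm (- y) (- w) h)))
    (≐-trans (geomMul-cong w (geomMul-cong y (linMul-cong (- w) (linMul⁻-geomMul y (geomMul w f)))))
             (geomMul-cong w (geomMul-cong y (linMul⁻-geomMul w f))))))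
    where
    h = geomMul y (geomMul w f)

  linMuls : List Carrier → Series F → Series F
  linMuls []       h = h
  linMuls (z ∷ zs) h = linMul z (linMuls zs h)

  geomOnes : List Carrier → Series F
  geomOnes []       = oneS F
  geomOnes (y ∷ ys) = geomMul y (geomOnes ys)

  superSeries : List Carrier → List Carrier → Series F
  superSeries ys zs = linMuls zs (geomOnes ys)

  linMuls-cong : ∀ zs {f g} → f ≐ g → linMuls zs f ≐ linMuls zs g
  linMuls-cong []       f≐g = f≐g
  linMuls-cong (z ∷ zs) f≐g = linMul-cong z (linMuls-cong zs f≐g)

  superH≈superSeries : ∀ k ys zs → superH F k ys zs ≈ superSeries ys zs k
  superH≈superSeries k ys zs = trans (⋆-congʳ _ (geoms ys) k) (lins zs (geomOnes ys) k)
    where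
    geoms : ∀ ys → foldr _⋆_ (oneS F) (map (geomS F) ys) ≐ geomOnes ys
    geoms []       k = refl
    geoms (y ∷ ys)   = ≐-trans (⋆-congʳ (geomS F y) (geoms ys)) (geomS-⋆ y (geomOnes ys))
    lins : ∀ zs h → foldr _⋆_ (oneS F) (map (linS F) zs) ⋆ h ≐ linMuls zs h
    lins []       h = oneS-⋆ h
    lins (z ∷ zs) h = ≐-trans (linS-⋆-assoc z _ h) (linMul-cong z (lins zs h))

  superSeries-snocʸ : ∀ ys y zs k →
    superSeries (ys ++ y ∷ []) zs (suc k) ≈ superSeries ys zs (suc k) + y * superSeries (ys ++ y ∷ []) zs k
  superSeries-snocʸ ys y zs k = trans (snoc (suc k)) (+-congˡ (*-congˡ (sym (snoc k))))
    where
    geomOnes-snoc : ∀ ys → geomOnes (ys ++ y ∷ []) ≐ geomMul y (geomOnes ys)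
    geomOnes-snoc []        k = refl
    geomOnes-snoc (y′ ∷ ys)   = ≐-trans (geomMul-cong y′ (geomOnes-snoc ys)) (geomMul-comm y′ y _)
    linMuls-geomMul : ∀ zs h → linMuls zs (geomMul y h) ≐ geomMul y (linMuls zs h)
    linMuls-geomMul []       h k = refl
    linMuls-geomMul (z ∷ zs) h   = ≐-trans (linMul-cong z (linMuls-geomMul zs h)) (linMul-geomMul z y _)
    snoc : superSeries (ys ++ y ∷ []) zs ≐ geomMul y (superSeries ys zs)
    snoc = ≐-trans (linMuls-cong zs (geomOnes-snoc ys)) (linMuls-geomMul zs (geomOnes ys))

  superSeries-snocᶻ : ∀ ys zs z k → superSeries ys (zs ++ z ∷ []) (suc k) ≈ superSeries ys zs (suc k) + z * superSeries ys zs k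
  superSeries-snocᶻ ys zs z = linMuls-snoc zs (geomOnes ys) ∘ suc
    where
    linMuls-snoc : ∀ zs h → linMuls (zs ++ z ∷ []) h ≐ linMul z (linMuls zs h)
    linMuls-snoc []        h k = refl
    linMuls-snoc (z′ ∷ zs) h   = ≐-trans (linMul-cong z′ (linMuls-snoc zs h)) (linMul-comm z′ z _)

  superSeries-zero : ∀ ys zs → superSeries ys zs 0 ≈ 1#
  superSeries-zero ys       (z ∷ zs) = superSeries-zero ys zs
  superSeries-zero []       []       = refl
  superSeries-zero (y ∷ ys) []       = superSeries-zero ys []

  superSeries-vanishes : ∀ zs k → length zs < k → superSeries [] zs k ≈ 0#
  superSeries-vanishes []       (suc k) _          = refl
  superSeries-vanishes (z ∷ zs) (suc k) (s≤s zs<k) = begin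
    superSeries [] zs (suc k) + z * superSeries [] zs k
      ≈⟨ +-cong (superSeries-vanishes zs (suc k) (ℕₚ.m<n⇒m<1+n zs<k)) (*-congˡ (superSeries-vanishes zs k zs<k)) ⟩
    0# + z * 0# ≈⟨ trans (+-identityˡ _) (zeroʳ z) ⟩
    0# ∎

  -- Change of factorial basis

  oneTo-snoc : ∀ n → oneTo (suc n) ≡ oneTo n ++ suc n ∷ []
  oneTo-snoc n = ≡.trans (≡.cong (map suc) (≡.sym (upTo-∷ʳ n))) (map-++ suc (upTo n) (n ∷ []))

  map-twoTo-snoc : ∀ {a} {A : Set a} (f : ℕ → A) n → map f (twoTo F (suc n)) ≡ map f (twoTo F n) ++ f (suc (suc n)) ∷ []
  map-twoTo-snoc f n = ≡.trans (≡.cong (map f ∘ map suc) (oneTo-snoc n))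
                        (≡.trans (≡.cong (map f) (map-++ suc (oneTo n) _)) (map-++ f (twoTo F n) _))

  length-map-twoTo : ∀ {a} {A : Set a} (f : ℕ → A) n → length (map f (twoTo F n)) ≡ n
  length-map-twoTo f n = ≡.trans (length-map f (twoTo F n)) (≡.trans (length-map suc (oneTo n))
                           (≡.trans (length-map suc (upTo n)) (length-upTo n)))

  fpow-snoc : ∀ y (c : ℕ → Carrier) k → fpow F y c (suc k) ≈ fpow F y c k * (y - c (suc k))
  fpow-snoc y c k = begin
    prodL F (map (λ m → y - c m) (oneTo (suc k)))              ≡⟨ ≡.cong (prodL F ∘ map (λ m → y - c m)) (oneTo-snoc k) ⟩
    prodL F (map (λ m → y - c m) (oneTo k ++ suc k ∷ []))      ≈⟨ prodL-++ _ (oneTo k) _ ⟩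
    fpow F y c k * ((y - c (suc k)) * 1#)                      ≈⟨ *-congˡ (*-identityʳ _) ⟩
    fpow F y c k * (y - c (suc k))                             ∎

  ∑₁ : ℕ → (ℕ → Carrier) → Carrier
  ∑₁ zero    h = 0#
  ∑₁ (suc N) h = ∑₁ N h + h (suc N)

  ∑₁-cong : ∀ N {f g : ℕ → Carrier} → (∀ v → 1 ≤ v → v ≤ N → f v ≈ g v) → ∑₁ N f ≈ ∑₁ N g
  ∑₁-cong zero    f≈g = refl
  ∑₁-cong (suc N) f≈g =
    +-cong (∑₁-cong N (λ v 1≤v v≤N → f≈g v 1≤v (ℕₚ.m≤n⇒m≤1+n v≤N))) (f≈g (suc N) (s≤s z≤n) ℕₚ.≤-refl)

  ∑₁-zero : ∀ N {f : ℕ → Carrier} → (∀ v → 1 ≤ v → v ≤ N → f v ≈ 0#) → ∑₁ N f ≈ 0#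
  ∑₁-zero N f≈0 = trans (∑₁-cong N f≈0) (zeros N)
    where
    zeros : ∀ N → ∑₁ N (λ _ → 0#) ≈ 0#
    zeros zero    = refl
    zeros (suc N) = trans (+-identityʳ _) (zeros N)

  ∑₁-shift : ∀ N (h : ℕ → Carrier) → ∑₁ (suc N) h ≈ h 1 + ∑₁ N (h ∘ suc)
  ∑₁-shift zero    h = trans (+-identityˡ _) (sym (+-identityʳ _))
  ∑₁-shift (suc N) h = trans (+-congʳ (∑₁-shift N h)) (+-assoc _ _ _)

  ∑₁-distrib-+ : ∀ N (f g : ℕ → Carrier) → ∑₁ N (λ v → f v + g v) ≈ ∑₁ N f + ∑₁ N g
  ∑₁-distrib-+ zero    f g = sym (+-identityˡ _)
  ∑₁-distrib-+ (suc N) f g = trans (+-congʳ (∑₁-distrib-+ N f g)) (+-interchange _ _ _ _)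

  *-distribˡ-∑₁ : ∀ N x (f : ℕ → Carrier) → x * ∑₁ N f ≈ ∑₁ N (λ v → x * f v)
  *-distribˡ-∑₁ zero    x f = zeroʳ x
  *-distribˡ-∑₁ (suc N) x f = trans (distribˡ x _ _) (+-congʳ (*-distribˡ-∑₁ N x f))

  *-distribʳ-∑₁ : ∀ N x (f : ℕ → Carrier) → ∑₁ N f * x ≈ ∑₁ N (λ v → f v * x)
  *-distribʳ-∑₁ N x f = trans (*-comm _ _) (trans (*-distribˡ-∑₁ N x f) (∑₁-cong N (λ v _ _ → *-comm _ _)))

  ∑₁-extend : ∀ r N (h : ℕ → Carrier) → r ≤ N → (∀ v → r < v → h v ≈ 0#) → ∑₁ N h ≈ ∑₁ r h
  ∑₁-extend r N h r≤N h≈0 = go N r≤N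
    where
    go : ∀ N → r ≤ N → ∑₁ N h ≈ ∑₁ r h
    go N r≤N with ℕₚ.m≤n⇒m<n∨m≡n r≤N
    ... | inj₂ ≡.refl     = refl
    ... | inj₁ (s≤s r≤N′) = trans (+-cong (go _ r≤N′) (h≈0 _ (s≤s r≤N′))) (+-identityʳ _)

  ∑₁-∑-comm : ∀ N n (f : ℕ → Fin n → Carrier) → ∑₁ N (λ v → ∑ n (f v)) ≈ ∑ n (λ i → ∑₁ N (λ v → f v i))
  ∑₁-∑-comm zero    n f = sym (∑-zero n (λ _ → refl))
  ∑₁-∑-comm (suc N) n f = trans (+-congʳ (∑₁-∑-comm N n f)) (sym (∑-distrib-+ n _ _))

  -‿∑₁ : ∀ N (f : ℕ → Carrier) → - ∑₁ N f ≈ ∑₁ N (λ v → - f v)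
  -‿∑₁ zero    f = -0#≈0#
  -‿∑₁ (suc N) f = trans (sym (-‿+-comm _ _)) (+-congʳ (-‿∑₁ N f))

  module Expansion (a b : ℕ → Carrier) (a₁≈0 : a 1 ≈ 0#) (b₁≈0 : b 1 ≈ 0#) where

    d : ℕ → ℕ → Carrier
    d r v = dcoef F r v a b

    Y : ℕ → List Carrier
    Y v = map b (twoTo F v)

    Z : ℕ → List Carrier
    Z n = map (λ k → - a k) (twoTo F n)

    d≈superSeries : ∀ r v → v ≤ r → d r v ≈ superSeries (Y v) (Z (r ∸ 1)) (r ∸ v)
    d≈superSeries r v v≤r with r <ᵇ v in r<ᵇv
    ... | true  = ⊥-elim (ℕₚ.<⇒≱ (ℕₚ.<ᵇ⇒< r v (≡.subst T (≡.sym r<ᵇv) _)) v≤r)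
    ... | false = superH≈superSeries (r ∸ v) (Y v) (Z (r ∸ 1))

    d-vanishes : ∀ r v → r < v → d r v ≈ 0#
    d-vanishes r v r<v with r <ᵇ v in r<ᵇv
    ... | true  = refl
    ... | false = ⊥-elim (≡.subst T r<ᵇv (ℕₚ.<⇒<ᵇ r<v))

    d-diag : ∀ r → d r r ≈ 1#
    d-diag r = trans (d≈superSeries r r ℕₚ.≤-refl)
                     (trans (reflexive (≡.cong (superSeries (Y r) (Z (r ∸ 1))) (ℕₚ.n∸n≡0 r))) (superSeries-zero (Y r) (Z (r ∸ 1))))

    -- h_r in the r - 1 variables -a₂, …, -a_r vanishes.
    d-zero : ∀ r → d (suc r) 0 ≈ 0#
    d-zero r = trans (d≈superSeries (suc r) 0 z≤n) (superSeries-vanishes (Z r) (suc r) (s≤s (ℕₚ.≤-reflexive (length-map-twoTo _ r))))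

    d-rec : ∀ R v → v ≤ suc R →
            d (suc (suc R)) (suc v) ≈ d (suc R) v + (b (suc (suc v)) - a (suc (suc R))) * d (suc R) (suc v)
    d-rec R v v≤ with ℕₚ.m≤n⇒m<n∨m≡n v≤
    ... | inj₂ ≡.refl = begin
      d (suc v) (suc v)                  ≈⟨ d-diag (suc v) ⟩
      1#                                 ≈⟨ d-diag v ⟨
      d v v                              ≈⟨ +-identityʳ _ ⟨
      d v v + 0#                         ≈⟨ +-congˡ (trans (*-congˡ (d-vanishes v (suc v) ℕₚ.≤-refl)) (zeroʳ _)) ⟨
      d v v + β * d v (suc v)            ∎
      where β = b (suc (suc v)) - a (suc v)
    ... | inj₁ v<R = begin
      d (suc (suc R)) (suc v)
        ≈⟨ d≈superSeries (suc R′) (suc v) (s≤s v≤) ⟩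
      superSeries (Y (suc v)) (Z (suc R)) (R′ ∸ v)
        ≡⟨ ≡.cong₂ (λ zs k → superSeries (Y (suc v)) zs k) (map-twoTo-snoc _ R) R′∸v≡ ⟩
      superSeries (Y (suc v)) (Z R ++ - a (suc R′) ∷ []) (suc t)
        ≈⟨ superSeries-snocᶻ (Y (suc v)) (Z R) _ t ⟩
      superSeries (Y (suc v)) (Z R) (suc t) + - a (suc R′) * X
        ≡⟨ ≡.cong (λ ys → superSeries ys (Z R) (suc t) + - a (suc R′) * X) (map-twoTo-snoc b v) ⟩
      superSeries (Y v ++ b (suc (suc v)) ∷ []) (Z R) (suc t) + - a (suc R′) * X
        ≈⟨ +-congʳ (trans (superSeries-snocʸ (Y v) _ (Z R) t) (+-congˡ (*-congˡ (reflexive X≡)))) ⟩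
      (superSeries (Y v) (Z R) (suc t) + b (suc (suc v)) * X) + - a (suc R′) * X
        ≈⟨ trans (+-assoc _ _ _) (+-congˡ (sym (distribʳ X _ _))) ⟩
      superSeries (Y v) (Z R) (suc t) + (b (suc (suc v)) - a (suc R′)) * X
        ≈⟨ +-cong (sym (trans (d≈superSeries R′ v v≤) (reflexive (≡.cong (superSeries (Y v) (Z R)) R′∸v≡))))
                  (*-congˡ (sym (d≈superSeries R′ (suc v) v<R))) ⟩
      d R′ v + (b (suc (suc v)) - a (suc R′)) * d R′ (suc v) ∎
      where
      R′ = suc R
      t  = R′ ∸ suc v
      X  = superSeries (Y (suc v)) (Z R) t
      R′∸v≡ : R′ ∸ v ≡ suc t
      R′∸v≡ = ℕₚ.+-∸-assoc 1 v<R
      X≡ : superSeries (map b (twoTo F v) ++ b (suc (suc v)) ∷ []) (Z R) t ≡ X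
      X≡ = ≡.cong (λ ys → superSeries ys (Z R) t) (≡.sym (map-twoTo-snoc b v))

    fpow-step : ∀ y v a′ → fpow F y b v * (y - a′) ≈ fpow F y b (suc v) + (b (suc v) - a′) * fpow F y b v
    fpow-step y v a′ = begin
      fpow F y b v * (y - a′)                                        ≈⟨ *-congˡ split ⟩
      fpow F y b v * ((y - b (suc v)) + (b (suc v) - a′))            ≈⟨ distribˡ _ _ _ ⟩
      fpow F y b v * (y - b (suc v)) + fpow F y b v * (b (suc v) - a′) ≈⟨ +-cong (fpow-snoc y b v) (*-comm _ _) ⟨
      fpow F y b (suc v) + (b (suc v) - a′) * fpow F y b v           ∎
      where
      split : y - a′ ≈ (y - b (suc v)) + (b (suc v) - a′)
      split = begin
        y - a′                                ≈⟨ +-congˡ (+-identityˡ _) ⟨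
        y + (0# - a′)                         ≈⟨ +-congˡ (+-congʳ (-‿inverseˡ (b (suc v)))) ⟨
        y + ((- b (suc v) + b (suc v)) - a′)  ≈⟨ +-congˡ (+-assoc _ _ _) ⟩
        y + (- b (suc v) + (b (suc v) - a′))  ≈⟨ +-assoc _ _ _ ⟨
        (y - b (suc v)) + (b (suc v) - a′)    ∎

    expand-suc : ∀ r y → fpow F y a (suc r) ≈ ∑₁ (suc r) (λ v → d (suc r) v * fpow F y b v)
    expand-suc zero y = begin
      (y - a 1) * 1#            ≈⟨ *-congʳ (+-congˡ (-‿cong (trans a₁≈0 (sym b₁≈0)))) ⟩
      (y - b 1) * 1#            ≈⟨ *-identityˡ _ ⟨
      1# * fpow F y b 1         ≈⟨ *-congʳ (d-diag 1) ⟨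
      d 1 1 * fpow F y b 1      ≈⟨ +-identityˡ _ ⟨
      0# + d 1 1 * fpow F y b 1 ∎
    expand-suc (suc r) y = begin
      fpow F y a (suc R)
        ≈⟨ fpow-snoc y a R ⟩
      fpow F y a R * (y - a (suc R))
        ≈⟨ *-congʳ (expand-suc r y) ⟩
      ∑₁ R (λ v → d R v * fb v) * (y - a (suc R))
        ≈⟨ trans (*-distribʳ-∑₁ R _ _) (∑₁-cong R (λ v _ _ → multiply-out v)) ⟩
      ∑₁ R (λ v → d R v * fb (suc v) + β v * (d R v * fb v))
        ≈⟨ ∑₁-distrib-+ R _ _ ⟩
      ∑₁ R (λ v → d R v * fb (suc v)) + ∑₁ R (λ v → β v * (d R v * fb v))
        ≈⟨ +-cong shifted extended ⟩
      ∑₁ (suc R) (λ v → d R (v ∸ 1) * fb v) + ∑₁ (suc R) (λ v → β v * (d R v * fb v))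
        ≈⟨ ∑₁-distrib-+ (suc R) _ _ ⟨
      ∑₁ (suc R) (λ v → d R (v ∸ 1) * fb v + β v * (d R v * fb v))
        ≈⟨ ∑₁-cong (suc R) recurrence ⟩
      ∑₁ (suc R) (λ v → d (suc R) v * fb v) ∎
      where
      R  = suc r
      fb = fpow F y b
      β : ℕ → Carrier
      β v = b (suc v) - a (suc R)
      multiply-out : ∀ v → d R v * fb v * (y - a (suc R)) ≈ d R v * fb (suc v) + β v * (d R v * fb v)
      multiply-out v = trans (*-assoc _ _ _) (trans (*-congˡ (fpow-step y v _)) (trans (distribˡ _ _ _) (+-congˡ (*-leftComm _ _ _))))
      shifted : ∑₁ R (λ v → d R v * fb (suc v)) ≈ ∑₁ (suc R) (λ v → d R (v ∸ 1) * fb v)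
      shifted = sym (trans (∑₁-shift R _) (trans (+-congʳ (trans (*-congʳ (d-zero r)) (zeroˡ _))) (+-identityˡ _)))
      extended : ∑₁ R (λ v → β v * (d R v * fb v)) ≈ ∑₁ (suc R) (λ v → β v * (d R v * fb v))
      extended = sym (trans (+-congˡ (trans (*-congˡ (trans (*-congʳ (d-vanishes R (suc R) ℕₚ.≤-refl)) (zeroˡ _))) (zeroʳ _)))
                            (+-identityʳ _))
      recurrence : ∀ v → 1 ≤ v → v ≤ suc R → d R (v ∸ 1) * fb v + β v * (d R v * fb v) ≈ d (suc R) v * fb v
      recurrence (suc w) _ (s≤s w≤R) = begin
        d R w * fb (suc w) + β (suc w) * (d R (suc w) * fb (suc w)) ≈⟨ +-congˡ (*-assoc _ _ _) ⟨
        d R w * fb (suc w) + β (suc w) * d R (suc w) * fb (suc w)   ≈⟨ distribʳ _ _ _ ⟨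
        (d R w + β (suc w) * d R (suc w)) * fb (suc w)              ≈⟨ *-congʳ (d-rec r w w≤R) ⟨
        d (suc R) (suc w) * fb (suc w)                              ∎

    expand : ∀ r N y → 1 ≤ r → r ≤ N → fpow F y a r ≈ ∑₁ N (λ v → d r v * fpow F y b v)
    expand (suc r) N y _ r<N = trans (expand-suc r y) (sym (∑₁-extend (suc r) N _ r<N λ v r<v →
      trans (*-congʳ (d-vanishes (suc r) v r<v)) (zeroˡ _)))

  -- Determinants

  sign : ℕ → Carrier
  sign zero    = 1#
  sign (suc t) = - sign t

  minor : ∀ {n} → (Fin (suc n) → Fin (suc n) → Carrier) → Fin (suc n) → Fin (suc n) → Fin n → Fin n → Carrier
  minor M i k a b = M (punchIn i a) (punchIn k b)

  signs-agree : ∀ (s : ℕ → Carrier) → s 0 ≡ 1# → (∀ t → s (suc t) ≡ - s t) → ∀ t → s t ≈ sign t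
  signs-agree s s₀ s-suc zero    = reflexive s₀
  signs-agree s s₀ s-suc (suc t) = trans (reflexive (s-suc t)) (-‿cong (signs-agree s s₀ s-suc t))

  -- The sign function of Defs.det is local to it and only ever applied to some toℕ k. Abstracting the tail of
  -- allFin (suc n), as it appears in the normalised goal, and then toℕ k exposes it at a variable, where
  -- unification identifies it.
  det-expandL : ∀ n M → det F (suc n) M ≈ ∑L (allFin (suc n)) (λ k → sign (toℕ k) * (M zero k * det F n (minor M zero k)))
  det-expandL n M with tabulate {n = n} (λ x → id (suc x))
  ... | []     = refl
  ... | k ∷ ks with toℕ k
  ...   | t = +-congˡ (+-cong (*-congʳ (agree t)) (∑L-cong ks (λ k → *-congʳ (agree (toℕ k)))))
    where agree = signs-agree _ ≡.refl (λ _ → ≡.refl)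

  det-expand : ∀ n M → det F (suc n) M ≈ ∑ (suc n) (λ k → sign (toℕ k) * (M zero k * det F n (minor M zero k)))
  det-expand n M = trans (det-expandL n M) (sumL-allFin (suc n) _)

  det-cong : ∀ n {M M′ : Fin n → Fin n → Carrier} → (∀ i j → M i j ≈ M′ i j) → det F n M ≈ det F n M′
  det-cong zero    M≈M′ = refl
  det-cong (suc n) {M} {M′} M≈M′ = trans (det-expand n M) (trans (∑-cong (suc n) λ k →
    *-congˡ (*-cong (M≈M′ zero k) (det-cong n (λ a b → M≈M′ (punchIn zero a) (punchIn k b))))) (sym (det-expand n M′)))

  det-expand-column : ∀ n M → det F (suc n) M ≈ ∑ (suc n) (λ i → sign (toℕ i) * (M i zero * det F n (minor M i zero)))
  det-expand-column zero    M = trans (det-expand zero M) (∑-cong 1 λ { zero → refl })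
  det-expand-column (suc n) M = begin
    det F (suc (suc n)) M
      ≈⟨ trans (det-expand (suc n) M) (∑-suc (suc n) _) ⟩
    corner + ∑ (suc n) (λ k → - sign (toℕ k) * (M zero (suc k) * det F (suc n) (minor M zero (suc k))))
      ≈⟨ +-congˡ (∑-cong (suc n) λ k → *-congˡ (*-congˡ (det-expand-column n (minor M zero (suc k))))) ⟩
    corner + ∑ (suc n) (λ k → - sign (toℕ k) * (M zero (suc k) * ∑ (suc n) (λ a → sign (toℕ a) * (M (suc a) zero * m₂ a k))))
      ≈⟨ +-congˡ (∑-cong (suc n) λ k → trans (*-congˡ (*-distribˡ-∑ (suc n) _ _)) (*-distribˡ-∑ (suc n) _ _)) ⟩
    corner + ∑ (suc n) (λ k → ∑ (suc n) (λ a → - sign (toℕ k) * (M zero (suc k) * (sign (toℕ a) * (M (suc a) zero * m₂ a k)))))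
      ≈⟨ +-congˡ (∑-comm (suc n) (suc n) _) ⟩
    corner + ∑ (suc n) (λ a → ∑ (suc n) (λ k → - sign (toℕ k) * (M zero (suc k) * (sign (toℕ a) * (M (suc a) zero * m₂ a k)))))
      ≈⟨ +-congˡ (∑-cong (suc n) λ a → ∑-cong (suc n) λ k → rearrange _ _ _ _ _) ⟩
    corner + ∑ (suc n) (λ a → ∑ (suc n) (λ k → - sign (toℕ a) * (M (suc a) zero * (sign (toℕ k) * (M zero (suc k) * m₂ a k)))))
      ≈⟨ +-congˡ (∑-cong (suc n) λ a → trans (sym (*-distribˡ-∑ (suc n) _ _)) (*-congˡ (sym (*-distribˡ-∑ (suc n) _ _)))) ⟩
    corner + ∑ (suc n) (λ a → - sign (toℕ a) * (M (suc a) zero * ∑ (suc n) (λ k → sign (toℕ k) * (M zero (suc k) * m₂ a k))))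
      ≈⟨ +-congˡ (∑-cong (suc n) λ a → *-congˡ (*-congˡ (sym (det-expand n (minor M (suc a) zero))))) ⟩
    corner + ∑ (suc n) (λ a → - sign (toℕ a) * (M (suc a) zero * det F (suc n) (minor M (suc a) zero)))
      ≈⟨ ∑-suc (suc n) _ ⟨
    ∑ (suc (suc n)) (λ i → sign (toℕ i) * (M i zero * det F (suc n) (minor M i zero))) ∎
    where
    corner = 1# * (M zero zero * det F (suc n) (minor M zero zero))
    m₂ : Fin (suc n) → Fin (suc n) → Carrier
    m₂ a k = det F n (λ a′ b′ → M (suc (punchIn a a′)) (suc (punchIn k b′)))
    rearrange : ∀ s t p q m → - s * (p * (t * (q * m))) ≈ - t * (q * (s * (p * m)))
    rearrange s t p q m = begin
      - s * (p * (t * (q * m)))   ≈⟨ -‿distribˡ-* _ _ ⟨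
      - (s * (p * (t * (q * m)))) ≈⟨ -‿cong (solve 5 (λ s t p q m → s ⊕ (p ⊕ (t ⊕ (q ⊕ m))) ⊜ t ⊕ (q ⊕ (s ⊕ (p ⊕ m))))
                                                refl s t p q m) ⟩
      - (t * (q * (s * (p * m)))) ≈⟨ -‿distribˡ-* _ _ ⟩
      - t * (q * (s * (p * m)))   ∎

  Decreasing : ∀ {l} → (Fin l → ℕ) → Set
  Decreasing r = ∀ i j → toℕ i ≤ toℕ j → r j ≤ r i

  toℕ-punchIn≤ : ∀ {n} (k : Fin (suc n)) (i : Fin n) → toℕ (punchIn k i) ≤ suc (toℕ i)
  toℕ-punchIn≤ zero    i       = ℕₚ.≤-refl
  toℕ-punchIn≤ (suc k) zero    = z≤n
  toℕ-punchIn≤ (suc k) (suc i) = s≤s (toℕ-punchIn≤ k i)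

  module _ (D : ℕ → ℕ → Carrier) (D≈0 : ∀ u v → u < v → D u v ≈ 0#) where

    ExpansionTerm : ∀ n (r s : Fin (suc n) → ℕ) → Fin (suc n) → Carrier
    ExpansionTerm n r s k = sign (toℕ k) * (D (r zero) (s k) * det F n (λ i j → D (r (suc i)) (s (punchIn k j))))

    det-vanishes : ∀ l (r s : Fin l → ℕ) → Decreasing r → Decreasing s → ∀ p → r p < s p →
                   det F l (λ i j → D (r i) (s j)) ≈ 0#
    expansion-term-vanishes : ∀ n (r s : Fin (suc n) → ℕ) → Decreasing r → Decreasing s → ∀ p → r p < s p → ∀ k →
                              ExpansionTerm n r s k ≈ 0#
    minor-vanishes : ∀ n (r s : Fin (suc n) → ℕ) → Decreasing r → Decreasing s → ∀ k p → r (suc p) < s (punchIn k p) →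
                     ExpansionTerm n r s k ≈ 0#

    det-vanishes (suc n) r s r↓ s↓ p rp<sp =
      trans (det-expand n (λ i j → D (r i) (s j))) (∑-zero (suc n) (expansion-term-vanishes n r s r↓ s↓ p rp<sp))

    expansion-term-vanishes n       r s r↓ s↓ zero    rp<sp zero    = trans (*-congˡ (trans (*-congʳ (D≈0 _ _ rp<sp)) (zeroˡ _))) (zeroʳ _)
    expansion-term-vanishes (suc n) r s r↓ s↓ zero    rp<sp (suc k) =
      minor-vanishes (suc n) r s r↓ s↓ (suc k) zero (ℕₚ.≤-<-trans (r↓ zero (suc zero) z≤n) rp<sp)
    expansion-term-vanishes n       r s r↓ s↓ (suc p) rp<sp k       =
      minor-vanishes n r s r↓ s↓ k p (ℕₚ.<-≤-trans rp<sp (s↓ _ _ (toℕ-punchIn≤ k p)))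

    minor-vanishes n r s r↓ s↓ k p lt = trans (*-congˡ (trans (*-congˡ minor≈0) (zeroʳ _))) (zeroʳ _)
      where
      minor≈0 = det-vanishes n (r ∘ suc) (s ∘ punchIn k) (λ i j i≤j → r↓ (suc i) (suc j) (s≤s i≤j))
                  (λ i j i≤j → s↓ _ _ (punchIn-mono-≤ k i j i≤j)) p lt

  -- Multilinear alternating sums

  Alternating : (List ℕ → Carrier) → Set ℓ
  Alternating Φ = ∀ p v w r → Φ (p ++ v ∷ w ∷ r) ≈ - Φ (p ++ w ∷ v ∷ r)

  Alternating-∷ : ∀ {Φ} u → Alternating Φ → Alternating (λ ν → Φ (u ∷ ν))
  Alternating-∷ {Φ} u Φ-alt p = Φ-alt (u ∷ p)

  Alternating-repeat : ∀ {Φ} → Alternating Φ → ∀ w ν → w ∈ ν → Φ (w ∷ ν) ≈ 0#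
  Alternating-repeat Φ-alt w (w ∷ ν) (here ≡.refl) = x≈-x⇒x≈0 (Φ-alt [] w w ν)
  Alternating-repeat {Φ} Φ-alt w (u ∷ ν) (there w∈ν) =
    trans (Φ-alt [] w u ν) (trans (-‿cong (Alternating-repeat {λ ν → Φ (u ∷ ν)} (Alternating-∷ {Φ} u Φ-alt) w ν w∈ν)) -0#≈0#)

  part-swap : ∀ p v w r i → part (p ++ v ∷ w ∷ r) i ≡ part (p ++ w ∷ v ∷ r) (adjSwap (length p) i)
  part-swap []      v w r zero          = ≡.refl
  part-swap []      v w r (suc zero)    = ≡.refl
  part-swap []      v w r (suc (suc i)) = ≡.refl
  part-swap (u ∷ p) v w r zero          = ≡.refl
  part-swap (u ∷ p) v w r (suc i)       = part-swap p v w r i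

  length-swap : ∀ (p : List ℕ) v w r → length (p ++ v ∷ w ∷ r) ≡ length (p ++ w ∷ v ∷ r)
  length-swap []      v w r = ≡.refl
  length-swap (u ∷ p) v w r = ≡.cong suc (length-swap p v w r)

  swap-in-range : ∀ (p : List ℕ) v w r → suc (length p) < length (p ++ w ∷ v ∷ r)
  swap-in-range []      v w r = s≤s (s≤s z≤n)
  swap-in-range (u ∷ p) v w r = s≤s (swap-in-range p v w r)

  Pexp-alternating : ∀ (B : ℕ → Carrier → Carrier) m (x : Fin m → Carrier) → Distinct x →
                     Alternating (λ ν → Pexp (length ν) (λ i → B (part ν i)) m x)
  Pexp-alternating B m x x-distinct p v w r = begin
    Pexp (length ν) (B ∘ part ν) m x                              ≡⟨ ≡.cong (λ l → Pexp l (B ∘ part ν) m x) (length-swap p v w r) ⟩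
    Pexp (length ν′) (B ∘ part ν) m x                             ≈⟨ Pexp-cong (length ν′) m (λ i u → ≡.cong (λ j → B j u) (part-swap p v w r i)) (λ _ → ≡.refl) ⟩
    Pexp (length ν′) (B ∘ part ν′ ∘ adjSwap (length p)) m x       ≈⟨ Pexp-swap (length p) (length ν′) (B ∘ part ν′) m x x-distinct (swap-in-range p v w r) ⟩
    - Pexp (length ν′) (B ∘ part ν′) m x                          ∎
    where
    ν  = p ++ v ∷ w ∷ r
    ν′ = p ++ w ∷ v ∷ r

  multiSum : ℕ → (l : ℕ) → (Fin l → ℕ → Carrier) → (List ℕ → Carrier) → Carrier
  multiSum N zero    R Φ = Φ []
  multiSum N (suc l) R Φ = ∑₁ N (λ v → R zero v * multiSum N l (R ∘ suc) (λ ν → Φ (v ∷ ν)))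

  multiSum-cong : ∀ N l R {Φ Ψ : List ℕ → Carrier} → (∀ ν → Φ ν ≈ Ψ ν) → multiSum N l R Φ ≈ multiSum N l R Ψ
  multiSum-cong N zero    R Φ≈Ψ = Φ≈Ψ []
  multiSum-cong N (suc l) R Φ≈Ψ = ∑₁-cong N (λ v _ _ → *-congˡ (multiSum-cong N l (R ∘ suc) (Φ≈Ψ ∘ (v ∷_))))

  multiSum-zero : ∀ N l R {Φ : List ℕ → Carrier} → (∀ ν → Φ ν ≈ 0#) → multiSum N l R Φ ≈ 0#
  multiSum-zero N zero    R Φ≈0 = Φ≈0 []
  multiSum-zero N (suc l) R Φ≈0 = ∑₁-zero N (λ v _ _ → trans (*-congˡ (multiSum-zero N l (R ∘ suc) (Φ≈0 ∘ (v ∷_)))) (zeroʳ _))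

  *-distribˡ-multiSum : ∀ N l R x (Φ : List ℕ → Carrier) → x * multiSum N l R Φ ≈ multiSum N l R (λ ν → x * Φ ν)
  *-distribˡ-multiSum N zero    R x Φ = refl
  *-distribˡ-multiSum N (suc l) R x Φ = trans (*-distribˡ-∑₁ N x _) (∑₁-cong N (λ v _ _ →
    trans (*-leftComm x _ _) (*-congˡ (*-distribˡ-multiSum N l (R ∘ suc) x _))))

  -‿multiSum : ∀ N l R (Φ : List ℕ → Carrier) → - multiSum N l R Φ ≈ multiSum N l R (λ ν → - Φ ν)
  -‿multiSum N zero    R Φ = refl
  -‿multiSum N (suc l) R Φ = trans (-‿∑₁ N _) (∑₁-cong N (λ v _ _ →
    trans (-‿distribʳ-* _ _) (*-congˡ (-‿multiSum N l (R ∘ suc) _))))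

  multiSum-∑-comm : ∀ N l R n (Φ : Fin n → List ℕ → Carrier) →
                    multiSum N l R (λ ν → ∑ n (λ k → Φ k ν)) ≈ ∑ n (λ k → multiSum N l R (Φ k))
  multiSum-∑-comm N zero    R n Φ = refl
  multiSum-∑-comm N (suc l) R n Φ = trans (∑₁-cong N (λ v _ _ → trans (*-congˡ (multiSum-∑-comm N l (R ∘ suc) n _)) (*-distribˡ-∑ n _ _)))
                                          (∑₁-∑-comm N n _)

  multiSum-restrict : ∀ N l R (Ψ : List ℕ → Carrier) → (∀ ν → suc N ∈ ν → Ψ ν ≈ 0#) → multiSum (suc N) l R Ψ ≈ multiSum N l R Ψ
  multiSum-restrict N zero    R Ψ Ψ≈0 = refl
  multiSum-restrict N (suc l) R Ψ Ψ≈0 =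
    trans (+-cong (∑₁-cong N (λ v _ _ → *-congˡ (multiSum-restrict N l (R ∘ suc) _ (λ ν → Ψ≈0 (v ∷ ν) ∘ there))))
                  (trans (*-congˡ (multiSum-zero (suc N) l (R ∘ suc) (λ ν → Ψ≈0 (suc N ∷ ν) (here ≡.refl)))) (zeroʳ _)))
          (+-identityʳ _)

  Pexp-multilinear : ∀ N l (G : Factors) (R : Fin l → ℕ → Carrier) (B : ℕ → Carrier → Carrier) m x →
    (∀ i y → G (toℕ i) y ≈ ∑₁ N (λ v → R i v * B v y)) →
    Pexp l G m x ≈ multiSum N l R (λ ν → Pexp (length ν) (λ i → B (part ν i)) m x)
  Pexp-multilinear N zero    G R B m       x G≈ = refl
  Pexp-multilinear N (suc l) G R B zero    x G≈ = sym (multiSum-zero N (suc l) R (λ ν → refl))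
  Pexp-multilinear N (suc l) G R B (suc m) x G≈ = begin
    ∑ (suc m) (λ k → G 0 (x k) * (ρ-prod x k * Pexp l (G ∘ suc) m (x ∘ punchIn k)))
      ≈⟨ ∑-cong (suc m) (λ k → *-cong (G≈ zero (x k)) (*-congˡ (Pexp-multilinear N l (G ∘ suc) (R ∘ suc) B m _ (G≈ ∘ suc)))) ⟩
    ∑ (suc m) (λ k → ∑₁ N (λ v → R zero v * B v (x k)) * (ρ-prod x k * multiSum N l (R ∘ suc) (Φ m (x ∘ punchIn k))))
      ≈⟨ ∑-cong (suc m) (λ k → trans (*-distribʳ-∑₁ N _ _) (∑₁-cong N λ v _ _ → pull-in v k)) ⟩
    ∑ (suc m) (λ k → ∑₁ N (λ v → R zero v * multiSum N l (R ∘ suc) (λ ν → B v (x k) * (ρ-prod x k * Φ m (x ∘ punchIn k) ν))))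
      ≈⟨ ∑₁-∑-comm N (suc m) _ ⟨
    ∑₁ N (λ v → ∑ (suc m) (λ k → R zero v * multiSum N l (R ∘ suc) (λ ν → B v (x k) * (ρ-prod x k * Φ m (x ∘ punchIn k) ν))))
      ≈⟨ ∑₁-cong N (λ v _ _ → trans (sym (*-distribˡ-∑ (suc m) _ _)) (*-congˡ (sym (multiSum-∑-comm N l (R ∘ suc) (suc m) _)))) ⟩
    multiSum N (suc l) R (Φ (suc m) x) ∎
    where
    Φ : ∀ m → (Fin m → Carrier) → List ℕ → Carrier
    Φ m x ν = Pexp (length ν) (λ i → B (part ν i)) m x
    pull-in : ∀ v k → R zero v * B v (x k) * (ρ-prod x k * multiSum N l (R ∘ suc) (Φ m (x ∘ punchIn k))) ≈
                      R zero v * multiSum N l (R ∘ suc) (λ ν → B v (x k) * (ρ-prod x k * Φ m (x ∘ punchIn k) ν))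
    pull-in v k = trans (*-assoc _ _ _) (*-congˡ (trans (*-congˡ (*-distribˡ-multiSum N l _ _ _)) (*-distribˡ-multiSum N l _ _ _)))

  multiSum-last : ∀ N l R Φ → Alternating Φ →
    multiSum (suc N) (suc l) R Φ ≈
    ∑₁ N (λ v → R zero v * multiSum (suc N) l (R ∘ suc) (λ ν → Φ (v ∷ ν)))
      + R zero (suc N) * multiSum N l (R ∘ suc) (λ ν → Φ (suc N ∷ ν))
  multiSum-last N l R Φ Φ-alt =
    +-congˡ (*-congˡ (multiSum-restrict N l (R ∘ suc) _ (Alternating-repeat {Φ} Φ-alt (suc N))))

  -- Moving the new top value suc N to the front of ν costs a sign, by alternation.
  cross-terms : ∀ N l R Φ → Alternating Φ →
    ∑₁ N (λ v → R zero v * ∑ (suc l) (λ i →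
      sign (toℕ i) * (R (suc i) (suc N) * multiSum N l (R ∘ suc ∘ punchIn i) (λ ν → Φ (v ∷ suc N ∷ ν)))))
    ≈ ∑ (suc l) (λ i → sign (toℕ (suc i)) * (R (suc i) (suc N) * multiSum N (suc l) (R ∘ punchIn (suc i)) (λ ν → Φ (suc N ∷ ν))))
  cross-terms N l R Φ Φ-alt = begin
    ∑₁ N (λ v → R zero v * ∑ (suc l) (λ i → s i * (r i * M i (λ ν → Φ (v ∷ suc N ∷ ν)))))
      ≈⟨ ∑₁-cong N (λ v _ _ → *-distribˡ-∑ (suc l) _ _) ⟩
    ∑₁ N (λ v → ∑ (suc l) (λ i → R zero v * (s i * (r i * M i (λ ν → Φ (v ∷ suc N ∷ ν))))))
      ≈⟨ ∑₁-∑-comm N (suc l) _ ⟩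
    ∑ (suc l) (λ i → ∑₁ N (λ v → R zero v * (s i * (r i * M i (λ ν → Φ (v ∷ suc N ∷ ν))))))
      ≈⟨ ∑-cong (suc l) (λ i → ∑₁-cong N (λ v _ _ → *-congˡ (*-congˡ (*-congˡ (swap-front v))))) ⟩
    ∑ (suc l) (λ i → ∑₁ N (λ v → R zero v * (s i * (r i * - M i (λ ν → Φ (suc N ∷ v ∷ ν))))))
      ≈⟨ ∑-cong (suc l) (λ i → ∑₁-cong N (λ v _ _ → rearrange _ _ _ _)) ⟩
    ∑ (suc l) (λ i → ∑₁ N (λ v → - s i * (r i * (R zero v * M i (λ ν → Φ (suc N ∷ v ∷ ν))))))
      ≈⟨ ∑-cong (suc l) (λ i → trans (sym (*-distribˡ-∑₁ N _ _)) (*-congˡ (sym (*-distribˡ-∑₁ N _ _)))) ⟩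
    ∑ (suc l) (λ i → - s i * (r i * multiSum N (suc l) (R ∘ punchIn (suc i)) (λ ν → Φ (suc N ∷ ν)))) ∎
    where
    s : Fin (suc l) → Carrier
    s i = sign (toℕ i)
    r : Fin (suc l) → Carrier
    r i = R (suc i) (suc N)
    M : Fin (suc l) → (List ℕ → Carrier) → Carrier
    M i = multiSum N l (R ∘ suc ∘ punchIn i)
    swap-front : ∀ v {i} → M i (λ ν → Φ (v ∷ suc N ∷ ν)) ≈ - M i (λ ν → Φ (suc N ∷ v ∷ ν))
    swap-front v = trans (multiSum-cong N l _ (Φ-alt [] v (suc N))) (sym (-‿multiSum N l _ _))
    rearrange : ∀ a b c m → a * (b * (c * - m)) ≈ - b * (c * (a * m))
    rearrange a b c m = begin
      a * (b * (c * - m))   ≈⟨ *-congˡ (*-congˡ (-‿distribʳ-* c m)) ⟨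
      a * (b * - (c * m))   ≈⟨ *-congˡ (-‿distribʳ-* b _) ⟨
      a * - (b * (c * m))   ≈⟨ -‿distribʳ-* a _ ⟨
      - (a * (b * (c * m))) ≈⟨ -‿cong (solve 4 (λ a b c m → a ⊕ (b ⊕ (c ⊕ m)) ⊜ b ⊕ (c ⊕ (a ⊕ m))) refl a b c m) ⟩
      - (b * (c * (a * m))) ≈⟨ -‿distribˡ-* b _ ⟩
      - b * (c * (a * m))   ∎

  multiSum-suc : ∀ N l R Φ → Alternating Φ →
    multiSum (suc N) (suc l) R Φ ≈
    multiSum N (suc l) R Φ + ∑ (suc l) (λ i → sign (toℕ i) * (R i (suc N) * multiSum N l (R ∘ punchIn i) (λ ν → Φ (suc N ∷ ν))))
  multiSum-suc N zero R Φ Φ-alt = trans (multiSum-last N 0 R Φ Φ-alt)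
    (+-congˡ (sym (trans (∑-suc 0 _) (trans (+-cong (*-identityˡ _) (∑-empty _)) (+-identityʳ _)))))
  multiSum-suc N (suc l) R Φ Φ-alt = begin
    multiSum (suc N) (suc (suc l)) R Φ
      ≈⟨ multiSum-last N (suc l) R Φ Φ-alt ⟩
    ∑₁ N (λ v → R zero v * multiSum (suc N) (suc l) (R ∘ suc) (λ ν → Φ (v ∷ ν))) + T₀
      ≈⟨ +-congʳ (∑₁-cong N (λ v _ _ → *-congˡ (multiSum-suc N l (R ∘ suc) (λ ν → Φ (v ∷ ν)) (Alternating-∷ {Φ} v Φ-alt)))) ⟩
    ∑₁ N (λ v → R zero v * (multiSum N (suc l) (R ∘ suc) (λ ν → Φ (v ∷ ν)) + C v)) + T₀
      ≈⟨ +-congʳ (trans (∑₁-cong N (λ v _ _ → distribˡ _ _ _)) (∑₁-distrib-+ N _ _)) ⟩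
    multiSum N (suc (suc l)) R Φ + ∑₁ N (λ v → R zero v * C v) + T₀
      ≈⟨ +-assoc _ _ _ ⟩
    multiSum N (suc (suc l)) R Φ + (∑₁ N (λ v → R zero v * C v) + T₀)
      ≈⟨ +-congˡ (trans (+-cong (cross-terms N l R Φ Φ-alt) (sym (*-identityˡ T₀))) (+-comm _ _)) ⟩
    multiSum N (suc (suc l)) R Φ + (1# * T₀ + ∑ (suc l) (λ i → sign (toℕ (suc i)) * (R (suc i) (suc N) * multiSum N (suc l) (R ∘ punchIn (suc i)) Ψ)))
      ≈⟨ +-congˡ (∑-suc (suc l) _) ⟨
    multiSum N (suc (suc l)) R Φ + ∑ (suc (suc l)) (λ i → sign (toℕ i) * (R i (suc N) * multiSum N (suc l) (R ∘ punchIn i) Ψ)) ∎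
    where
    Ψ = λ ν → Φ (suc N ∷ ν)
    T₀ = R zero (suc N) * multiSum N (suc l) (R ∘ suc) Ψ
    C : ℕ → Carrier
    C v = ∑ (suc l) (λ i → sign (toℕ i) * (R (suc i) (suc N) * multiSum N l (R ∘ suc ∘ punchIn i) (λ ν → Φ (v ∷ suc N ∷ ν))))

  cubeSum : ℕ → ℕ → (List ℕ → Carrier) → Carrier
  cubeSum N zero    H = H []
  cubeSum N (suc l) H = ∑₁ N (λ v → cubeSum N l (λ ν → H (v ∷ ν)))

  cubeSum-cong : ∀ N l {H H′ : List ℕ → Carrier} → (∀ ν → length ν ≡ l → All (_≤ N) ν → H ν ≈ H′ ν) →
                 cubeSum N l H ≈ cubeSum N l H′
  cubeSum-cong N zero    H≈H′ = H≈H′ [] ≡.refl []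
  cubeSum-cong N (suc l) H≈H′ =
    ∑₁-cong N (λ v _ v≤N → cubeSum-cong N l (λ ν |ν|≡l ν≤N → H≈H′ (v ∷ ν) (≡.cong suc |ν|≡l) (v≤N ∷ ν≤N)))

  cubeSum-zero : ∀ N l {H : List ℕ → Carrier} → (∀ ν → length ν ≡ l → H ν ≈ 0#) → cubeSum N l H ≈ 0#
  cubeSum-zero N zero    H≈0 = H≈0 [] ≡.refl
  cubeSum-zero N (suc l) H≈0 = ∑₁-zero N (λ v _ _ → cubeSum-zero N l (λ ν |ν|≡l → H≈0 (v ∷ ν) (≡.cong suc |ν|≡l)))

  *-distribˡ-cubeSum : ∀ N l x (H : List ℕ → Carrier) → x * cubeSum N l H ≈ cubeSum N l (λ ν → x * H ν)
  *-distribˡ-cubeSum N zero    x H = refl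
  *-distribˡ-cubeSum N (suc l) x H = trans (*-distribˡ-∑₁ N x _) (∑₁-cong N (λ v _ _ → *-distribˡ-cubeSum N l x _))

  cubeSum-∑-comm : ∀ N l n (H : Fin n → List ℕ → Carrier) → cubeSum N l (λ ν → ∑ n (λ i → H i ν)) ≈ ∑ n (λ i → cubeSum N l (H i))
  cubeSum-∑-comm N zero    n H = refl
  cubeSum-∑-comm N (suc l) n H = trans (∑₁-cong N (λ v _ _ → cubeSum-∑-comm N l n _)) (∑₁-∑-comm N n _)

  cubeSum-restrict : ∀ N l (H : List ℕ → Carrier) → (∀ ν → suc N ∈ ν → H ν ≈ 0#) → cubeSum (suc N) l H ≈ cubeSum N l H
  cubeSum-restrict N zero    H H≈0 = refl
  cubeSum-restrict N (suc l) H H≈0 =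
    trans (+-cong (∑₁-cong N (λ v _ _ → cubeSum-restrict N l _ (λ ν → H≈0 (v ∷ ν) ∘ there)))
                  (cubeSum-zero (suc N) l (λ ν _ → H≈0 (suc N ∷ ν) (here ≡.refl))))
          (+-identityʳ _)

  strict-head : ∀ v u ν → T (isStrictᵇ (v ∷ u ∷ ν)) → u < v
  strict-head v u ν strict = ℕₚ.<ᵇ⇒< u v (proj₁ (Equivalence.to T-∧ strict))

  strict-tail : ∀ v u ν → T (isStrictᵇ (v ∷ u ∷ ν)) → T (isStrictᵇ (u ∷ ν))
  strict-tail v u ν strict = proj₂ (Equivalence.to T-∧ strict)

  strict-∈ : ∀ v ν {w} → T (isStrictᵇ (v ∷ ν)) → w ∈ ν → w < v
  strict-∈ v (u ∷ ν) strict (here ≡.refl) = strict-head v u ν strict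
  strict-∈ v (u ∷ ν) strict (there w∈ν)   = ℕₚ.<-trans (strict-∈ u ν (strict-tail v u ν strict) w∈ν) (strict-head v u ν strict)

  strict-decreasing : ∀ μ → T (isStrictᵇ μ) → ∀ i j → i ≤ j → part μ j ≤ part μ i
  strict-decreasing []          strict i       j       i≤j       = z≤n
  strict-decreasing (v ∷ μ)     strict zero    zero    i≤j       = ℕₚ.≤-refl
  strict-decreasing (v ∷ [])    strict (suc i) (suc j) i≤j       = z≤n
  strict-decreasing (v ∷ [])    strict zero    (suc j) i≤j       = z≤n
  strict-decreasing (v ∷ u ∷ μ) strict zero    (suc j) i≤j       =
    ℕₚ.≤-trans (strict-decreasing (u ∷ μ) (strict-tail v u μ strict) 0 j z≤n) (ℕₚ.<⇒≤ (strict-head v u μ strict))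
  strict-decreasing (v ∷ u ∷ μ) strict (suc i) (suc j) (s≤s i≤j) = strict-decreasing (u ∷ μ) (strict-tail v u μ strict) i j i≤j

  strict-positive : ∀ μ → T (isStrictᵇ μ) → ∀ i → i < length μ → 1 ≤ part μ i
  strict-positive (v ∷ [])    strict zero    _         = ℕₚ.<ᵇ⇒< 0 v strict
  strict-positive (v ∷ [])    strict (suc i) (s≤s ())
  strict-positive (v ∷ u ∷ μ) strict zero    _         = ℕₚ.≤-<-trans z≤n (strict-head v u μ strict)
  strict-positive (v ∷ u ∷ μ) strict (suc i) (s≤s i<) = strict-positive (u ∷ μ) (strict-tail v u μ strict) i i<

  strict-≤-head : ∀ μ → T (isStrictᵇ μ) → All (_≤ part μ 0) μ
  strict-≤-head []      strict = []
  strict-≤-head (v ∷ μ) strict = ℕₚ.≤-refl ∷ All.tabulate (ℕₚ.<⇒≤ ∘ strict-∈ v μ strict)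

  strict-cons : ∀ N ν → All (_≤ N) ν → isStrictᵇ (suc N ∷ ν) ≡ isStrictᵇ ν
  strict-cons N []      []            = ≡.refl
  strict-cons N (u ∷ ν) (u≤N ∷ ν≤N) with u <ᵇ suc N in u<ᵇ
  ... | true  = ≡.refl
  ... | false = ⊥-elim (≡.subst T u<ᵇ (ℕₚ.<⇒<ᵇ (s≤s u≤N)))

  detTerm : (l : ℕ) → (Fin l → ℕ → Carrier) → (List ℕ → Carrier) → List ℕ → Carrier
  detTerm l R Φ ν = if isStrictᵇ ν then det F l (λ i j → R i (part ν (toℕ j))) * Φ ν else 0#

  strictSum : ℕ → (l : ℕ) → (Fin l → ℕ → Carrier) → (List ℕ → Carrier) → Carrier
  strictSum N l R Φ = cubeSum N l (detTerm l R Φ)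

  detTerm-repeat : ∀ l R Φ N v ν → v ≤ suc N → suc N ∈ ν → detTerm l R Φ (v ∷ ν) ≈ 0#
  detTerm-repeat l R Φ N v ν v≤ N∈ν with isStrictᵇ (v ∷ ν) in strict
  ... | true  = ⊥-elim (ℕₚ.<⇒≱ (strict-∈ v ν (Equivalence.from T-≡ strict) N∈ν) v≤)
  ... | false = refl

  detTerm-top : ∀ N l R Φ ν → All (_≤ N) ν →
    detTerm (suc l) R Φ (suc N ∷ ν) ≈ ∑ (suc l) (λ i → sign (toℕ i) * (R i (suc N) * detTerm l (R ∘ punchIn i) (λ ν → Φ (suc N ∷ ν)) ν))
  detTerm-top N l R Φ ν ν≤N rewrite strict-cons N ν ν≤N with isStrictᵇ ν
  ... | false = sym (∑-zero (suc l) (λ i → trans (*-congˡ (zeroʳ _)) (zeroʳ _)))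
  ... | true  = begin
    det F (suc l) M * Φ (suc N ∷ ν)
      ≈⟨ *-congʳ (det-expand-column l M) ⟩
    ∑ (suc l) (λ i → sign (toℕ i) * (R i (suc N) * det F l (minor M i zero))) * Φ (suc N ∷ ν)
      ≈⟨ trans (*-comm _ _) (*-distribˡ-∑ (suc l) _ _) ⟩
    ∑ (suc l) (λ i → Φ (suc N ∷ ν) * (sign (toℕ i) * (R i (suc N) * det F l (minor M i zero))))
      ≈⟨ ∑-cong (suc l) (λ i → solve 4 (λ f s r d → f ⊕ (s ⊕ (r ⊕ d)) ⊜ s ⊕ (r ⊕ (d ⊕ f))) refl _ _ _ _) ⟩
    ∑ (suc l) (λ i → sign (toℕ i) * (R i (suc N) * (det F l (minor M i zero) * Φ (suc N ∷ ν)))) ∎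
    where
    M : Fin (suc l) → Fin (suc l) → Carrier
    M i j = R i (part (suc N ∷ ν) (toℕ j))

  strictSum-suc : ∀ N l R Φ →
    strictSum (suc N) (suc l) R Φ ≈
    strictSum N (suc l) R Φ + ∑ (suc l) (λ i → sign (toℕ i) * (R i (suc N) * strictSum N l (R ∘ punchIn i) (λ ν → Φ (suc N ∷ ν))))
  strictSum-suc N l R Φ = +-cong
    (∑₁-cong N (λ v _ v≤N → cubeSum-restrict N l _ (λ ν → detTerm-repeat (suc l) R Φ N v ν (ℕₚ.m≤n⇒m≤1+n v≤N))))
    (begin
      cubeSum (suc N) l (λ ν → detTerm (suc l) R Φ (suc N ∷ ν))
        ≈⟨ cubeSum-restrict N l _ (λ ν → detTerm-repeat (suc l) R Φ N (suc N) ν ℕₚ.≤-refl) ⟩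
      cubeSum N l (λ ν → detTerm (suc l) R Φ (suc N ∷ ν))
        ≈⟨ cubeSum-cong N l (λ ν _ → detTerm-top N l R Φ ν) ⟩
      cubeSum N l (λ ν → ∑ (suc l) (λ i → sign (toℕ i) * (R i (suc N) * detTerm l (R ∘ punchIn i) (λ ν → Φ (suc N ∷ ν)) ν)))
        ≈⟨ cubeSum-∑-comm N l (suc l) _ ⟩
      ∑ (suc l) (λ i → cubeSum N l (λ ν → sign (toℕ i) * (R i (suc N) * detTerm l (R ∘ punchIn i) (λ ν → Φ (suc N ∷ ν)) ν)))
        ≈⟨ ∑-cong (suc l) (λ i → trans (sym (*-distribˡ-cubeSum N l _ _)) (*-congˡ (sym (*-distribˡ-cubeSum N l _ _)))) ⟩
      ∑ (suc l) (λ i → sign (toℕ i) * (R i (suc N) * strictSum N l (R ∘ punchIn i) (λ ν → Φ (suc N ∷ ν)))) ∎)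

  multiSum≈strictSum : ∀ N l R Φ → Alternating Φ → multiSum N l R Φ ≈ strictSum N l R Φ
  multiSum≈strictSum N       zero    R Φ Φ-alt = sym (*-identityˡ _)
  multiSum≈strictSum zero    (suc l) R Φ Φ-alt = refl
  multiSum≈strictSum (suc N) (suc l) R Φ Φ-alt = begin
    multiSum (suc N) (suc l) R Φ
      ≈⟨ multiSum-suc N l R Φ Φ-alt ⟩
    multiSum N (suc l) R Φ + ∑ (suc l) (λ i → sign (toℕ i) * (R i (suc N) * multiSum N l (R ∘ punchIn i) Ψ))
      ≈⟨ +-cong (multiSum≈strictSum N (suc l) R Φ Φ-alt)
                (∑-cong (suc l) λ i → *-congˡ (*-congˡ (multiSum≈strictSum N l (R ∘ punchIn i) Ψ (Alternating-∷ {Φ} (suc N) Φ-alt)))) ⟩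
    strictSum N (suc l) R Φ + ∑ (suc l) (λ i → sign (toℕ i) * (R i (suc N) * strictSum N l (R ∘ punchIn i) Ψ))
      ≈⟨ strictSum-suc N l R Φ ⟨
    strictSum (suc N) (suc l) R Φ ∎
    where
    Ψ = λ ν → Φ (suc N ∷ ν)

  ∑L-oneTo : ∀ k (h : ℕ → Carrier) → ∑L (oneTo k) h ≈ ∑₁ k h
  ∑L-oneTo zero    h = refl
  ∑L-oneTo (suc k) h = begin
    ∑L (oneTo (suc k)) h            ≡⟨ ≡.cong (λ vs → ∑L vs h) (oneTo-snoc k) ⟩
    ∑L (oneTo k ++ suc k ∷ []) h    ≈⟨ sumL-++ h (oneTo k) _ ⟩
    ∑L (oneTo k) h + (h (suc k) + 0#) ≈⟨ +-cong (∑L-oneTo k h) (+-identityʳ _) ⟩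
    ∑₁ k h + h (suc k)              ∎

  outside-box : ∀ μ ν → length ν ≡ length μ → ¬ Pointwise _≥_ μ ν → ∃ λ (p : Fin (length μ)) → part μ (toℕ p) < part ν (toℕ p)
  outside-box []      []      _      ¬box = ⊥-elim (¬box [])
  outside-box (k ∷ μ) (v ∷ ν) |ν|≡|μ| ¬box with v ℕₚ.≤? k
  ... | no  v≰k = zero , ℕₚ.≰⇒> v≰k
  ... | yes v≤k with outside-box μ ν (ℕₚ.suc-injective |ν|≡|μ|) (¬box ∘ (v≤k ∷_))
  ...   | p , μp<νp = suc p , μp<νp

  cubeSum≈∑L-boxes : ∀ N μ (H : List ℕ → Carrier) → All (_≤ N) μ →
    (∀ ν → length ν ≡ length μ → ¬ Pointwise _≥_ μ ν → H ν ≈ 0#) → cubeSum N (length μ) H ≈ ∑L (boxes μ) H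
  cubeSum≈∑L-boxes N []      H []          H≈0 = sym (+-identityʳ _)
  cubeSum≈∑L-boxes N (k ∷ μ) H (k≤N ∷ μ≤N) H≈0 = begin
    ∑₁ N (λ v → cubeSum N (length μ) (H ∘ (v ∷_)))
      ≈⟨ ∑₁-extend k N _ k≤N (λ v k<v → cubeSum-zero N _ λ ν |ν| →
           H≈0 (v ∷ ν) (≡.cong suc |ν|) λ { (v≤k ∷ _) → ℕₚ.<⇒≱ k<v v≤k }) ⟩
    ∑₁ k (λ v → cubeSum N (length μ) (H ∘ (v ∷_)))
      ≈⟨ ∑₁-cong k (λ v _ _ → cubeSum≈∑L-boxes N μ _ μ≤N λ ν |ν| ¬box →
           H≈0 (v ∷ ν) (≡.cong suc |ν|) λ { (_ ∷ box) → ¬box box }) ⟩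
    ∑₁ k (λ v → ∑L (boxes μ) (H ∘ (v ∷_)))
      ≈⟨ ∑L-oneTo k _ ⟨
    ∑L (oneTo k) (λ v → ∑L (boxes μ) (H ∘ (v ∷_)))
      ≈⟨ ∑L-cong (oneTo k) (λ v → reflexive (≡.sym (∑L-map (v ∷_) (boxes μ) H))) ⟩
    ∑L (oneTo k) (λ v → ∑L (map (v ∷_) (boxes μ)) H)
      ≈⟨ ∑L-concatMap _ (oneTo k) H ⟨
    ∑L (boxes (k ∷ μ)) H ∎

  Qfun≈Pexp : ∀ λ′ c m x → Qfun F λ′ c m x ≈ pow F (1# + 1#) (length λ′) * Pexp (length λ′) (λ i y → fpow F y c (part λ′ i)) m x
  Qfun≈Pexp λ′ c m x = *-congˡ (trans (reflexive (Pfun≡Pgen λ′ c m x)) (Pgen≈Pexp (length λ′) (λ i y → fpow F y c (part λ′ i)) m x))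

  module QExpansion (a b : ℕ → Carrier) (a₁≈0 : a 1 ≈ 0#) (b₁≈0 : b 1 ≈ 0#) (μ : List ℕ) (μ-strict : T (isStrictᵇ μ))
                  (m : ℕ) (x : Fin m → Carrier) (x-distinct : Distinct x) where
    open Expansion a b a₁≈0 b₁≈0

    l : ℕ
    l = length μ

    N : ℕ
    N = part μ 0

    R : Fin l → ℕ → Carrier
    R i = d (part μ (toℕ i))

    Φ : List ℕ → Carrier
    Φ ν = Pexp (length ν) (λ i y → fpow F y b (part ν i)) m x

    two^ : ℕ → Carrier
    two^ = pow F (1# + 1#)

    summand : List ℕ → Carrier
    summand ν = if isStrictᵇ ν then dmat F μ ν a b * Qfun F ν b m x else 0#

    Pexp≈strictSum : Pexp l (λ i y → fpow F y a (part μ i)) m x ≈ strictSum N l R Φ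
    Pexp≈strictSum = begin
      Pexp l (λ i y → fpow F y a (part μ i)) m x   ≈⟨ Pexp-multilinear N l _ R (λ v y → fpow F y b v) m x fpow-a≈ ⟩
      multiSum N l R Φ                              ≈⟨ multiSum≈strictSum N l R Φ (Pexp-alternating (λ v y → fpow F y b v) m x x-distinct) ⟩
      strictSum N l R Φ                             ∎
      where
      fpow-a≈ : ∀ i y → fpow F y a (part μ (toℕ i)) ≈ ∑₁ N (λ v → R i v * fpow F y b v)
      fpow-a≈ i y = expand _ N y (strict-positive μ μ-strict (toℕ i) (toℕ<n i))
                              (strict-decreasing μ μ-strict 0 (toℕ i) z≤n)

    summand-outside-box : ∀ ν → length ν ≡ l → ¬ Pointwise _≥_ μ ν → summand ν ≈ 0#
    summand-outside-box ν |ν|≡l ¬box with isStrictᵇ ν in ν-strict | outside-box μ ν |ν|≡l ¬box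
    ... | false | _           = refl
    ... | true  | p , μp<νp = trans (*-congʳ dmat≈0) (zeroˡ _)
      where
      dmat≈0 : dmat F μ ν a b ≈ 0#
      dmat≈0 = det-vanishes d d-vanishes l (λ i → part μ (toℕ i)) (λ j → part ν (toℕ j))
                 (λ i j → strict-decreasing μ μ-strict (toℕ i) (toℕ j))
                 (λ i j → strict-decreasing ν (Equivalence.from T-≡ ν-strict) (toℕ i) (toℕ j)) p μp<νp

    two^*detTerm≈summand : ∀ ν → length ν ≡ l → two^ l * detTerm l R Φ ν ≈ summand ν
    two^*detTerm≈summand ν |ν|≡l with isStrictᵇ ν
    ... | false = zeroʳ _
    ... | true  = trans (*-leftComm _ _ _) (*-congˡ (trans (*-congʳ (reflexive (≡.cong two^ (≡.sym |ν|≡l)))) (sym (Qfun≈Pexp ν b m x))))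

    two^*strictSum≈∑subDP : two^ l * strictSum N l R Φ ≈ sumL F (map (λ ν → dmat F μ ν a b * Qfun F ν b m x) (subDP μ))
    two^*strictSum≈∑subDP = begin
      two^ l * strictSum N l R Φ                   ≈⟨ *-distribˡ-cubeSum N l _ _ ⟩
      cubeSum N l (λ ν → two^ l * detTerm l R Φ ν)   ≈⟨ cubeSum-cong N l (λ ν |ν|≡l _ → two^*detTerm≈summand ν |ν|≡l) ⟩
      cubeSum N l summand                            ≈⟨ cubeSum≈∑L-boxes N μ summand (strict-≤-head μ μ-strict) summand-outside-box ⟩
      ∑L (boxes μ) summand                           ≈⟨ ∑L-filter isStrictᵇ (boxes μ) _ ⟨
      ∑L (subDP μ) (λ ν → dmat F μ ν a b * Qfun F ν b m x) ∎

theorem10p2 : ∀ {c ℓ} (F : CharZeroField c ℓ) → let open CharZeroField F in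
    (a b : ℕ → Carrier) → a 1 ≈ 0# → b 1 ≈ 0# →
    (μ : List ℕ) → T (isStrictᵇ μ) →
    (m : ℕ) (x : Fin m → Carrier) → (∀ i j → ¬ (i ≡ j) → ¬ (x i ≈ x j)) →
    Qfun F μ a m x ≈ sumL F (map (λ ν → dmat F μ ν a b * Qfun F ν b m x) (subDP μ))
theorem10p2 F a b a₁≈0 b₁≈0 μ μ-strict m x x-distinct = begin
  Qfun F μ a m x                                        ≈⟨ Qfun≈Pexp μ a m x ⟩
  two^ l * Pexp l (λ i y → fpow F y a (part μ i)) m x   ≈⟨ *-congˡ Pexp≈strictSum ⟩
  two^ l * strictSum N l R Φ                            ≈⟨ two^*strictSum≈∑subDP ⟩
  sumL F (map (λ ν → dmat F μ ν a b * Qfun F ν b m x) (subDP μ)) ∎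
  where
  open CharZeroField F
  open FactorialQ F
  open QExpansion a b a₁≈0 b₁≈0 μ μ-strict m x x-distinct
  open import Relation.Binary.Reasoning.Setoid setoid
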